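{- Let $G$ be an Eulerian solid subgraph of the triangular lattice with $f$ bounded faces. Consider the tower-moves chain on $EO(G)$ with $p_T=\frac{1}{3h}$ for every tower of length $h$. Let $\sigma_1,\sigma_2\in EO(G)$ be such that $\sigma_2$ is obtained from $\sigma_1$ by reversing a single directed bounded face $A$, and consider the coupling described below started from $(X_t,Y_t)=(\sigma_1,\sigma_2)$. Suppose $B$ is a bounded face sharing an edge with $A$ that is directed in $\sigma_1$. Then $\mathbb{E}[\delta_{B}] = \frac{1}{3f}$.
   Context: Triangular lattice: vertices $v_{i,j}$ ($i,j\in\mathbb{Z}$), edges $\{v_{i,j},v_{i+1,j}\}$, $\{v_{i,j},v_{i,j+1}\}$, $\{v_{i,j},v_{i+1,j-1}\}$, standard planar embedding with triangular bounded faces. A solid subgraph is a cycle of the lattice together with everything in its interior; Eulerian means all degrees even. $EO(G)$ is the set of Eulerian orientations (in-degree = out-degree at every vertex). A bounded face is directed if its boundary edges form a directed cycle; almost-directed if all but one boundary edge share a common direction around the face, the exceptional edge being the blocking edge. A tower of length $h$ starting at $F_1$ is a sequence of faces $F_1,\dots,F_h$, consecutive ones sharing an edge, with $F_i$ ($i<h$) almost-directed with blocking edge shared with $F_{i+1}$, and $F_h$ directed. Reversing the tower means reversing all edges of $\bigoplus_i E(F_i)$. Tower-moves chain: with probability $1/2$ stay; otherwise choose a bounded face $F$ uniformly; if $F$ is directed reverse it; else if there is a tower $T$ of length $h$ starting at $F$, reverse it with probability $p_T=1/(3h)$; else stay. Distance: $\delta(\sigma,\sigma')$ is the shortest-path distance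 in the graph on $EO(G)$ whose edges join orientations differing by the reversal of a single directed face. Coupling from $(\sigma_1,\sigma_2)$: with probability $1/2-1/(2f)$ both chains stay; with probability $1/(2f)$ chain 1 moves using face $A$ and chain 2 stays; with probability $1/(2f)$ chain 2 moves using face $A$ and chain 1 stays; for each bounded face $F\ne A$, with probability $1/(2f)$ both chains attempt to move using $F$, where the tower-reversal coin flips are coupled so that both chains perform their respective moves with probability equal to the minimum of their individual move probabilities. The move at a face $F$ involves face $B$ if $F=B$ or there is a tower starting at $F$ that contains $B$. $\delta_B$ denotes the contribution to $\delta(X_{t+1},Y_{t+1})-\delta(X_t,Y_t)$ coming from selections of faces $F\neq A$ whose move involves $B$ in at least one of the two chains (i.e. the change in distance multiplied by the indicator that such a face was selected); $\mathbb{E}[\delta_B]$ is its expectation over one step of the coupling. -}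

module Defs where

open import Data.Bool using (Bool; true; false; _xor_; not; _∧_; T?)
open import Data.Nat as ℕ using (ℕ; zero; suc; _≤_)
open import Data.Nat using () renaming (_*_ to _*ℕ_)
open import Data.Integer as ℤ using (ℤ; +_; -[1+_])
open import Data.Fin using (Fin)
open import Data.Product using (_×_; _,_; Σ; ∃; proj₁; proj₂)
open import Data.Sum using (_⊎_)
open import Data.List using (List; []; _∷_; length; filter; map; foldr; zip; _++_; head; drop)
open import Data.List.Membership.Propositional using (_∈_)
open import Data.List.Relation.Unary.Unique.Propositional using (Unique)
open import Data.List.Relation.Unary.Any using (any?)
open import Relation.Binary.PropositionalEquality using (_≡_; _≢_)
open import Relation.Binary.Definitions using (DecidableEquality)
open import Relation.Nullary using (¬_; does)
open import Relation.Nullary.Decidable using (⌊_⌋)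
open import Data.Product.Properties using (≡-dec)
import Data.Integer.Properties as ℤP
import Data.Fin.Properties as FinP
import Data.Bool.Properties as BoolP
open import Data.Rational as ℚ using (ℚ; 0ℚ; 1ℚ; _/_; _⊓_; _⊔_; _+_; _-_; _*_)
open import Data.Nat.Divisibility using (_∣_)

-- Vertex (i , j) is v_{i,j}.  Lattice edges are represented canonically
-- as (v , d) with d : Fin 3:
--   d = 0 : {v_{i,j}, v_{i+1,j}}
--   d = 1 : {v_{i,j}, v_{i,j+1}}
--   d = 2 : {v_{i,j}, v_{i+1,j-1}}
-- i.e. the edge (v , d) joins v and v + step d.

Vertex : Set
Vertex = ℤ × ℤ

Edge : Set
Edge = Vertex × Fin 3

step : Fin 3 → Vertex
step Fin.zero = (+ 1 , + 0)
step (Fin.suc Fin.zero) = (+ 0 , + 1)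
step (Fin.suc (Fin.suc Fin.zero)) = (+ 1 , -[1+ 0 ])

_⊕_ : Vertex → Vertex → Vertex
(a , b) ⊕ (c , d) = (a ℤ.+ c , b ℤ.+ d)

_⊖_ : Vertex → Vertex → Vertex
(a , b) ⊖ (c , d) = (a ℤ.- c , b ℤ.- d)

Joins : Edge → Vertex → Vertex → Set
Joins (w , d) u v = (w ≡ u × w ⊕ step d ≡ v) ⊎ (w ≡ v × w ⊕ step d ≡ u)

-- Bounded faces of the lattice: (v , true) is the "up" triangle
-- {v_{i,j}, v_{i+1,j}, v_{i,j+1}}, (v , false) the "down" triangle
-- {v_{i+1,j}, v_{i,j+1}, v_{i+1,j+1}}  (v = (i , j)).
Face : Set
Face = Vertex × Bool

v0 v1 v2 : Fin 3
v0 = Fin.zero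
v1 = Fin.suc Fin.zero
v2 = Fin.suc (Fin.suc Fin.zero)

-- An orientation of (the edges of) G: true means the edge (w , d) is
-- directed from w to w + step d.
Orientation : Set
Orientation = Edge → Bool

-- The three boundary edges of a face, each with the orientation value
-- that makes it point counterclockwise around the face (standard
-- embedding v_{i,j} ↦ i(1,0) + j(1/2, √3/2)).
-- Up (i,j):   ccw cycle (i,j) → (i+1,j) → (i,j+1) → (i,j)
-- Down (i,j): ccw cycle (i+1,j) → (i+1,j+1) → (i,j+1) → (i+1,j)
faceEdges : Face → List (Edge × Bool)
faceEdges ((i , j) , true) =
  (((i , j) , v0) , true) ∷
  (((i , j ℤ.+ + 1) , v2) , false) ∷
  (((i , j) , v1) , false) ∷ []
faceEdges ((i , j) , false) =
  (((i ℤ.+ + 1 , j) , v1) , true) ∷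
  (((i , j ℤ.+ + 1) , v0) , false) ∷
  (((i , j ℤ.+ + 1) , v2) , true) ∷ []

edgesOf : Face → List Edge
edgesOf F = map proj₁ (faceEdges F)

_≟E_ : DecidableEquality Edge
_≟E_ = ≡-dec (≡-dec ℤP._≟_ ℤP._≟_) FinP._≟_

_≟F_ : DecidableEquality Face
_≟F_ = ≡-dec (≡-dec ℤP._≟_ ℤP._≟_) BoolP._≟_

edgeOfᵇ : Edge → Face → Bool
edgeOfᵇ e F = does (any? (e ≟E_) (edgesOf F))

countFaces : Edge → List Face → ℕ
countFaces e S = length (filter (λ F → any? (e ≟E_) (edgesOf F)) S)

-- Solid subgraphs, described by their list S of bounded faces.
-- G has as edges/vertices exactly those of the triangles in S.

InG : List Face → Edge → Set
InG S e = Σ Face λ F → F ∈ S × e ∈ edgesOf F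

inGᵇ : List Face → Edge → Bool
inGᵇ S e = does (any? (λ F → any? (e ≟E_) (edgesOf F)) S)

cyclicPairs : List Vertex → List (Vertex × Vertex)
cyclicPairs [] = []
cyclicPairs (x ∷ xs) = zip (x ∷ xs) (xs ++ (x ∷ []))

IsCycle : List Vertex → Set
IsCycle c = (3 ≤ length c) × Unique c ×
            (∀ u v → (u , v) ∈ cyclicPairs c → Σ Edge λ e → Joins e u v)

CycleEdge : List Vertex → Edge → Set
CycleEdge c e = Σ Vertex λ u → Σ Vertex λ v → (u , v) ∈ cyclicPairs c × Joins e u v

-- S is the set of bounded faces of a solid subgraph: S is a finite
-- set of lattice triangles whose (mod 2) boundary is a lattice cycle C.
-- (By planarity the triangles of S are then exactly those in the
-- interior of C, and G = C together with its interior is the union of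
-- the closed triangles of S.)
Solid : List Face → Set
Solid S = Unique S × Σ (List Vertex) λ c → IsCycle c ×
          (∀ e → (countFaces e S ≡ 1 → CycleEdge c e) × (CycleEdge c e → countFaces e S ≡ 1))

-- the six lattice edges at v, each with the orientation value meaning
-- "directed away from v"
incident : Vertex → List (Edge × Bool)
incident v =
  ((v , v0) , true) ∷ ((v , v1) , true) ∷ ((v , v2) , true) ∷
  ((v ⊖ step v0 , v0) , false) ∷ ((v ⊖ step v1 , v1) , false) ∷
  ((v ⊖ step v2 , v2) , false) ∷ []

degree : List Face → Vertex → ℕ
degree S v = length (filter (λ p → T? (inGᵇ S (proj₁ p))) (incident v))

Eulerian : List Face → Set
Eulerian S = ∀ v → 2 ∣ degree S v

_==_ : Bool → Bool → Bool
a == b = not (a xor b)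

outdeg indeg : List Face → Orientation → Vertex → ℕ
outdeg S σ v = length (filter (λ p → T? (inGᵇ S (proj₁ p) ∧ (σ (proj₁ p) == proj₂ p))) (incident v))
indeg S σ v = length (filter (λ p → T? (inGᵇ S (proj₁ p) ∧ not (σ (proj₁ p) == proj₂ p))) (incident v))

IsEO : List Face → Orientation → Set
IsEO S σ = ∀ v → outdeg S σ v ≡ indeg S σ v

EqOn : List Face → Orientation → Orientation → Set
EqOn S σ τ = ∀ e → InG S e → σ e ≡ τ e

ccwFlags : Orientation → Face → List Bool
ccwFlags σ F = map (λ p → σ (proj₁ p) == proj₂ p) (faceEdges F)

Directed : Orientation → Face → Set
Directed σ F with ccwFlags σ F
... | a ∷ b ∷ c ∷ [] = (a ≡ b) × (b ≡ c)
... | _ = Σ ℕ λ n → n ≡ suc n  -- impossible: faces have 3 edges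

AlmostDirected : Orientation → Face → Edge → Set
AlmostDirected σ F e with faceEdges F | ccwFlags σ F
... | (e₀ , _) ∷ (e₁ , _) ∷ (e₂ , _) ∷ [] | a ∷ b ∷ c ∷ [] =
        (e ≡ e₀ × b ≡ c × a ≢ b) ⊎ (e ≡ e₁ × a ≡ c × b ≢ a) ⊎ (e ≡ e₂ × a ≡ b × c ≢ a)
... | _ | _ = Σ ℕ λ n → n ≡ suc n  -- impossible

-- Towers (within the bounded faces S of G), as the list F₁ … F_h.
data Tower (S : List Face) (σ : Orientation) : Face → List Face → Set where
  top  : ∀ {F} → F ∈ S → Directed σ F → Tower S σ F (F ∷ [])
  next : ∀ {F F′ e T} → F ∈ S → AlmostDirected σ F e → e ∈ edgesOf F′ →
         F′ ≢ F → Tower S σ F′ T → Tower S σ F (F ∷ T)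

-- reversing all edges of ⊕_{F ∈ T} E(F)
reverseFaces : Orientation → List Face → Orientation
reverseFaces σ T e = σ e xor (countFaces e T ℕ.% 2 ℕ.≡ᵇ 1)

-- 1/n as a rational (n ≥ 1 in all uses; 1/0 is set to 0)
inv : ℕ → ℚ
inv zero = 0ℚ
inv (suc k) = + 1 / suc k

ofℕ : ℕ → ℚ
ofℕ n = + n / 1

sumℚ : List ℚ → ℚ
sumℚ = foldr _+_ 0ℚ

-- The tower-moves chain, after a bounded face F has been selected.
-- Move S σ F p T : the move at F reverses ⊕_{F' ∈ T} E(F') with
-- probability p (and otherwise stays).

data Move (S : List Face) (σ : Orientation) (F : Face) : ℚ → List Face → Set where
  mvDir   : Directed σ F → Move S σ F 1ℚ (F ∷ [])
  mvTower : ∀ {T} → ¬ Directed σ F → Tower S σ F T → Move S σ F (inv (3 *ℕ length T)) T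
  mvStay  : ¬ Directed σ F → (∀ T → ¬ Tower S σ F T) → Move S σ F 0ℚ []

Involves : List Face → Orientation → Face → Face → Set
Involves S σ F B = F ≡ B ⊎ Σ (List Face) λ T → Tower S σ F T × B ∈ T

-- The distance δ: shortest-path distance in the graph on EO(G) whose
-- edges join orientations differing by the reversal of a single
-- directed face.

data Path (S : List Face) : ℕ → Orientation → Orientation → Set where
  here     : ∀ {σ τ} → EqOn S σ τ → Path S 0 σ τ
  flipFace : ∀ {n σ τ F} → F ∈ S → Directed σ F →
             Path S n (reverseFaces σ (F ∷ [])) τ → Path S (suc n) σ τ

IsDist : List Face → Orientation → Orientation → ℕ → Set
IsDist S σ τ n = Path S n σ τ × (∀ m → Path S m σ τ → n ≤ m)

IsDistFn : List Face → (Orientation → Orientation → ℕ) → Set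
IsDistFn S d = ∀ σ τ → IsEO S σ → IsEO S τ → IsDist S σ τ (d σ τ)

-- For a selected face F (selected with probability 1/(2f)),
-- c F is the conditional expectation of
--   (δ(X_{t+1},Y_{t+1}) - δ(X_t,Y_t)) · 1[F ≠ A and the move at F
--                                         involves B in X_t or Y_t]
-- under the coupling, started from (X_t , Y_t) = (σ₁ , σ₂).
-- Given the individual moves (X moves w.p. pX reversing TX, Y moves
-- w.p. pY reversing TY), the coupled coins give:
--   both move w.p. pX ⊓ pY, only X w.p. pX - pX ⊓ pY,
--   only Y w.p. pY - pX ⊓ pY, neither w.p. 1 - pX ⊔ pY.

DeltaBCond : List Face → (Orientation → Orientation → ℕ) →
             Face → Face → Orientation → Orientation → (Face → ℚ) → Set
DeltaBCond S d A B σ₁ σ₂ c = ∀ F → F ∈ S →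
  (F ≡ A → c F ≡ 0ℚ) ×
  (F ≢ A → ¬ (Involves S σ₁ F B ⊎ Involves S σ₂ F B) → c F ≡ 0ℚ) ×
  (F ≢ A → (Involves S σ₁ F B ⊎ Involves S σ₂ F B) →
     ∀ pX TX pY TY → Move S σ₁ F pX TX → Move S σ₂ F pY TY →
     c F ≡ (let X′ = reverseFaces σ₁ TX
                Y′ = reverseFaces σ₂ TY
                Δ = λ x y → ofℕ (d x y) - ofℕ (d σ₁ σ₂)
                m = pX ⊓ pY
            in m * Δ X′ Y′ + (pX - m) * Δ X′ σ₂ + (pY - m) * Δ σ₁ Y′
               + (1ℚ - pX ⊔ pY) * Δ σ₁ σ₂))

ExpDeltaB : List Face → (Face → ℚ) → ℚ
ExpDeltaB S c = sumℚ (map (λ F → inv (2 *ℕ length S) * c F) S)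

-- Let σ₂ be σ₁ with A reversed, and call a tower of σ₁ whose top is B an ascent.  In σ₂ the face B
-- is almost-directed, blocked by the edge it shares with the directed face A, so an ascent F … B of
-- length h becomes the tower F … B A of σ₂; up to this extension the towers through B are the same in
-- σ₁ and σ₂.  For such an F ≠ B both chains move with probability 1/(3(h+1)) and meet (change -1),
-- and only X moves with probability 1/(3h) - 1/(3(h+1)), to distance h + 1 (change +h): on average
-- nothing.  For F = B, which X reverses with probability 1, the change is -1/6 + 5/6 = 2/3.  Hence
-- E[δ_B] = (1/(2f))·(2/3) = 1/(3f).
--
-- The distances are exact by parity: a flip sequence from σ to σ ⊕ K flips every face of K an odd
-- number of times, because a finite set of faces with empty boundary is empty.  That an ascent
-- consists of distinct faces away from A and can be undone face by face inside EO(G) comes from a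
-- height function of σ₁ (net flip counts along a flip sequence from σ₁ to its reversal), which rises
-- by one at each step of an ascent.

module Submission where

open import Defs
open import Data.Bool as Bool using (Bool; true; false; not; _xor_; _∧_; _∨_; T?)
open import Data.Bool.Properties
  using (∧-identityʳ; ∧-zeroʳ; ¬-not; not-¬; not-involutive; not-injective; not-distribˡ-xor;
         xor-same; xor-assoc; xor-comm; xor-identityʳ)
open import Data.Empty using (⊥-elim)
open import Data.Fin as Fin using (Fin)
open import Data.Integer as ℤ using (ℤ; +_; -[1+_])
open import Data.Nat as ℕ using (ℕ; zero; suc; _≤_; z≤n; s≤s)
import Data.Nat.Properties as ℕP
import Data.Integer.Properties as ℤP
import Algebra.Properties.AbelianGroup ℤP.+-0-abelianGroup as ℤ+
open import Data.Integer.Tactic.RingSolver using (solve-∀)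
open import Data.List using (List; []; _∷_; length; filter; map; _++_; applyUpTo)
import Data.List.Properties as ListP
open import Data.List.Membership.Propositional using (_∈_)
open import Data.List.Relation.Unary.All as All using (All; []; _∷_)
open import Data.List.Relation.Unary.All.Properties using (¬Any⇒All¬)
open import Data.List.Relation.Unary.Any as Any using (here; there; any?)
open import Data.List.Relation.Unary.AllPairs using ([]; _∷_)
open import Data.List.Relation.Unary.Unique.Propositional using (Unique)
import Data.List.Relation.Unary.Unique.Propositional.Properties as Unique
open import Data.List.Membership.Propositional.Properties using (∈-applyUpTo⁻; ∈-++⁻)
open import Data.Product using (_×_; _,_; Σ; proj₁; proj₂)
open import Data.Product.Properties using (,-injectiveˡ)
open import Data.Sum using (_⊎_; inj₁; inj₂; [_,_]′)
open import Data.Rational as ℚ using (ℚ; 0ℚ; 1ℚ; _/_; toℚᵘ)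
import Data.Rational.Properties as ℚP
open import Data.Rational.Unnormalised as ℚᵘ using (mkℚᵘ; *≡*; *≤*)
import Data.Rational.Unnormalised.Properties as ℚᵘP
open import Data.Rational.Solver using (module +-*-Solver)
open import Relation.Binary.PropositionalEquality
open import Relation.Nullary using (¬_; Dec; yes; no; does)
open import Relation.Nullary.Decidable using (dec-true; dec-false; does-⇔; decidable-stable)
open import Function.Bundles using (_⇔_; mk⇔)
open import Function.Construct.Composition using (_⇔-∘_)
open import Function.Construct.Symmetry using (⇔-sym)
open import Data.Nat.Tactic.RingSolver using () renaming (solve-∀ to solve-ℕ)


-- Lattice geometry

pattern d0 = Fin.zero
pattern d1 = Fin.suc Fin.zero
pattern d2 = Fin.suc (Fin.suc Fin.zero)

pattern up   v = v , true
pattern down v = v , false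

edge : Face → Fin 3 → Edge
edge (up (i , j))  d0 = ((i , j) , d0)
edge (up (i , j))  d1 = ((i , j) , d1)
edge (up (i , j))  d2 = ((i , j ℤ.+ + 1) , d2)
edge (down (i , j)) d0 = ((i , j ℤ.+ + 1) , d0)
edge (down (i , j)) d1 = ((i ℤ.+ + 1 , j) , d1)
edge (down (i , j)) d2 = ((i , j ℤ.+ + 1) , d2)

-- ccw isUp d: the value of an orientation on side d of an up (true) or down (false) triangle
-- that makes this side run counterclockwise, as in faceEdges.
ccw : Bool → Fin 3 → Bool
ccw true  d0 = true
ccw true  d1 = false
ccw true  d2 = false
ccw false d0 = false
ccw false d1 = true
ccw false d2 = true

neighbour : Face → Fin 3 → Face
neighbour (up (i , j))  d0 = down (i , j ℤ.- + 1)
neighbour (up (i , j))  d1 = down (i ℤ.- + 1 , j)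
neighbour (up (i , j))  d2 = down (i , j)
neighbour (down (i , j)) d0 = up (i , j ℤ.+ + 1)
neighbour (down (i , j)) d1 = up (i ℤ.+ + 1 , j)
neighbour (down (i , j)) d2 = up (i , j)

private
  -+1≡id : ∀ (x : ℤ) → x ℤ.- + 1 ℤ.+ + 1 ≡ x
  -+1≡id = solve-∀

  +-1≡id : ∀ (x : ℤ) → x ℤ.+ + 1 ℤ.- + 1 ≡ x
  +-1≡id = solve-∀

  +1-injective : ∀ (x y : ℤ) → x ℤ.+ + 1 ≡ y ℤ.+ + 1 → x ≡ y
  +1-injective = ℤ+.∙-cancelʳ (+ 1)

  +1≢id : ∀ (x : ℤ) → x ℤ.+ + 1 ≢ x
  +1≢id x eq = ℤP.i≢suc[i] (sym (trans (ℤP.+-comm (+ 1) x) eq))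

  -1≢id : ∀ (x : ℤ) → x ℤ.- + 1 ≢ x
  -1≢id x eq = +1≢id (x ℤ.- + 1) (trans (-+1≡id x) (sym eq))

  ,-injective : ∀ {a b c d : ℤ} → (a , b) ≡ (c , d) → a ≡ c × b ≡ d
  ,-injective refl = refl , refl

edge-direction : ∀ F d → proj₂ (edge F d) ≡ d
edge-direction (up _)  d0 = refl
edge-direction (up _)  d1 = refl
edge-direction (up _)  d2 = refl
edge-direction (down _) d0 = refl
edge-direction (down _) d1 = refl
edge-direction (down _) d2 = refl

neighbour-isUp : ∀ F d → proj₂ (neighbour F d) ≡ not (proj₂ F)
neighbour-isUp (up _)  d0 = refl
neighbour-isUp (up _)  d1 = refl
neighbour-isUp (up _)  d2 = refl
neighbour-isUp (down _) d0 = refl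
neighbour-isUp (down _) d1 = refl
neighbour-isUp (down _) d2 = refl

neighbour-edge : ∀ F d → edge (neighbour F d) d ≡ edge F d
neighbour-edge (up (i , j))  d0 = cong (λ z → ((i , z) , d0)) (-+1≡id j)
neighbour-edge (up (i , j))  d1 = cong (λ z → ((z , j) , d1)) (-+1≡id i)
neighbour-edge (up (i , j))  d2 = refl
neighbour-edge (down (i , j)) d0 = refl
neighbour-edge (down (i , j)) d1 = refl
neighbour-edge (down (i , j)) d2 = refl

neighbour-involutive : ∀ F d → neighbour (neighbour F d) d ≡ F
neighbour-involutive (up (i , j))  d0 = cong (λ z → up (i , z)) (-+1≡id j)
neighbour-involutive (up (i , j))  d1 = cong (λ z → up (z , j)) (-+1≡id i)
neighbour-involutive (up (i , j))  d2 = refl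
neighbour-involutive (down (i , j)) d0 = cong (λ z → down (i , z)) (+-1≡id j)
neighbour-involutive (down (i , j)) d1 = cong (λ z → down (z , j)) (+-1≡id i)
neighbour-involutive (down (i , j)) d2 = refl

neighbour-≢ : ∀ F d → neighbour F d ≢ F
neighbour-≢ F d eq with proj₂ F | trans (sym (cong proj₂ eq)) (neighbour-isUp F d)
... | true  | ()
... | false | ()

neighbour-injective : ∀ F {d d′} → neighbour F d ≡ neighbour F d′ → d ≡ d′
neighbour-injective (up (i , j))  {d0} {d0} eq = refl
neighbour-injective (up (i , j))  {d0} {d1} eq = ⊥-elim (-1≢id j (proj₂ (,-injective (,-injectiveˡ eq))))
neighbour-injective (up (i , j))  {d0} {d2} eq = ⊥-elim (-1≢id j (proj₂ (,-injective (,-injectiveˡ eq))))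
neighbour-injective (up (i , j))  {d1} {d0} eq = ⊥-elim (-1≢id i (proj₁ (,-injective (,-injectiveˡ eq))))
neighbour-injective (up (i , j))  {d1} {d1} eq = refl
neighbour-injective (up (i , j))  {d1} {d2} eq = ⊥-elim (-1≢id i (proj₁ (,-injective (,-injectiveˡ eq))))
neighbour-injective (up (i , j))  {d2} {d0} eq = ⊥-elim (-1≢id j (sym (proj₂ (,-injective (,-injectiveˡ eq)))))
neighbour-injective (up (i , j))  {d2} {d1} eq = ⊥-elim (-1≢id i (sym (proj₁ (,-injective (,-injectiveˡ eq)))))
neighbour-injective (up (i , j))  {d2} {d2} eq = refl
neighbour-injective (down (i , j)) {d0} {d0} eq = refl
neighbour-injective (down (i , j)) {d0} {d1} eq = ⊥-elim (+1≢id i (sym (proj₁ (,-injective (,-injectiveˡ eq)))))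
neighbour-injective (down (i , j)) {d0} {d2} eq = ⊥-elim (+1≢id j (proj₂ (,-injective (,-injectiveˡ eq))))
neighbour-injective (down (i , j)) {d1} {d0} eq = ⊥-elim (+1≢id i (proj₁ (,-injective (,-injectiveˡ eq))))
neighbour-injective (down (i , j)) {d1} {d1} eq = refl
neighbour-injective (down (i , j)) {d1} {d2} eq = ⊥-elim (+1≢id i (proj₁ (,-injective (,-injectiveˡ eq))))
neighbour-injective (down (i , j)) {d2} {d0} eq = ⊥-elim (+1≢id j (sym (proj₂ (,-injective (,-injectiveˡ eq)))))
neighbour-injective (down (i , j)) {d2} {d1} eq = ⊥-elim (+1≢id i (sym (proj₁ (,-injective (,-injectiveˡ eq)))))
neighbour-injective (down (i , j)) {d2} {d2} eq = refl

edge-injective : ∀ G F d → proj₂ G ≡ proj₂ F → edge G d ≡ edge F d → G ≡ F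
edge-injective (up (i , j)) (up (k , l)) d0 refl eq with ,-injective (,-injectiveˡ eq)
... | refl , refl = refl
edge-injective (up (i , j)) (up (k , l)) d1 refl eq with ,-injective (,-injectiveˡ eq)
... | refl , refl = refl
edge-injective (up (i , j)) (up (k , l)) d2 refl eq with ,-injective (,-injectiveˡ eq)
... | refl , j+1≡l+1 with +1-injective j l j+1≡l+1
... | refl = refl
edge-injective (down (i , j)) (down (k , l)) d0 refl eq with ,-injective (,-injectiveˡ eq)
... | refl , j+1≡l+1 with +1-injective j l j+1≡l+1
... | refl = refl
edge-injective (down (i , j)) (down (k , l)) d1 refl eq with ,-injective (,-injectiveˡ eq)
... | i+1≡k+1 , refl with +1-injective i k i+1≡k+1
... | refl = refl
edge-injective (down (i , j)) (down (k , l)) d2 refl eq with ,-injective (,-injectiveˡ eq)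
... | refl , j+1≡l+1 with +1-injective j l j+1≡l+1
... | refl = refl

edge-shared : ∀ G F d → edge G d ≡ edge F d → G ≡ F ⊎ G ≡ neighbour F d
edge-shared G F d eq with proj₂ G Bool.≟ proj₂ F
... | yes same  = inj₁ (edge-injective G F d same eq)
... | no differ = inj₂ (edge-injective G (neighbour F d) d (trans (¬-not differ) (sym (neighbour-isUp F d)))
                                       (trans eq (sym (neighbour-edge F d))))

edge∈edgesOf : ∀ F d → edge F d ∈ edgesOf F
edge∈edgesOf (up _)  d0 = here refl
edge∈edgesOf (up _)  d1 = there (there (here refl))
edge∈edgesOf (up _)  d2 = there (here refl)
edge∈edgesOf (down _) d0 = there (here refl)
edge∈edgesOf (down _) d1 = here refl
edge∈edgesOf (down _) d2 = there (there (here refl))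

edge∈edgesOf-neighbour : ∀ F d → edge F d ∈ edgesOf (neighbour F d)
edge∈edgesOf-neighbour F d = subst (_∈ edgesOf (neighbour F d)) (neighbour-edge F d) (edge∈edgesOf (neighbour F d) d)

∈edgesOf⇒edge : ∀ F {e} → e ∈ edgesOf F → edge F (proj₂ e) ≡ e
∈edgesOf⇒edge (up _)  (here refl)                 = refl
∈edgesOf⇒edge (up _)  (there (here refl))         = refl
∈edgesOf⇒edge (up _)  (there (there (here refl))) = refl
∈edgesOf⇒edge (down _) (here refl)                 = refl
∈edgesOf⇒edge (down _) (there (here refl))         = refl
∈edgesOf⇒edge (down _) (there (there (here refl))) = refl

edge∈edgesOf⇒adjacent : ∀ G F d → edge F d ∈ edgesOf G → G ≡ F ⊎ G ≡ neighbour F d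
edge∈edgesOf⇒adjacent G F d e∈G =
  edge-shared G F d (trans (cong (edge G) (sym (edge-direction F d))) (∈edgesOf⇒edge G e∈G))

∈edgesOf⇔ : ∀ F {w d} → (w , d) ∈ edgesOf F ⇔ w ≡ proj₁ (edge F d)
∈edgesOf⇔ F {w} {d} = mk⇔ (λ e∈F → sym (cong proj₁ (∈edgesOf⇒edge F e∈F)))
                          (λ { refl → subst (_∈ edgesOf F) (cong (proj₁ (edge F d) ,_) (edge-direction F d))
                                              (edge∈edgesOf F d) })


-- Directed and almost-directed faces

flag : Orientation → Face → Fin 3 → Bool
flag σ F d = σ (edge F d) == ccw (proj₂ F) d

private
  ==-not : ∀ x c → (x == not c) ≡ not (x == c)
  ==-not true  true  = refl
  ==-not true  false = refl
  ==-not false true  = refl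
  ==-not false false = refl

  not-== : ∀ x c → (not x == c) ≡ not (x == c)
  not-== true  true  = refl
  not-== true  false = refl
  not-== false true  = refl
  not-== false false = refl

  xor-== : ∀ x p c → ((x xor p) == c) ≡ (x == c) xor p
  xor-== true  true  true  = refl
  xor-== true  true  false = refl
  xor-== true  false true  = refl
  xor-== true  false false = refl
  xor-== false true  true  = refl
  xor-== false true  false = refl
  xor-== false false true  = refl
  xor-== false false false = refl

  not≢self : ∀ {x} → not x ≢ x
  not≢self p = not-¬ refl (sym p)

ccw-not : ∀ isUp d → ccw (not isUp) d ≡ not (ccw isUp d)
ccw-not true  d0 = refl
ccw-not true  d1 = refl
ccw-not true  d2 = refl
ccw-not false d0 = refl
ccw-not false d1 = refl
ccw-not false d2 = refl

flag-neighbour : ∀ σ F d → flag σ (neighbour F d) d ≡ not (flag σ F d)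
flag-neighbour σ F d rewrite neighbour-edge F d | neighbour-isUp F d | ccw-not (proj₂ F) d =
  ==-not (σ (edge F d)) (ccw (proj₂ F) d)

record DirectedAs (σ : Orientation) (F : Face) (c : Bool) : Set where
  constructor directed
  field side : ∀ d → flag σ F d ≡ c
open DirectedAs public

-- The blocking side d is the one whose flag differs from the sense a of the other two.
record AlmostDirectedAs (σ : Orientation) (F : Face) (d : Fin 3) (a : Bool) : Set where
  constructor almostDirected
  field side : ∀ d′ → flag σ F d′ ≡ does (d′ Fin.≟ d) xor a
open AlmostDirectedAs public

Directed⇒DirectedAs : ∀ σ F → Directed σ F → DirectedAs σ F (flag σ F d0)
Directed⇒DirectedAs σ F dir = directed (sides F dir)
  where
  sides : ∀ F → Directed σ F → ∀ d → flag σ F d ≡ flag σ F d0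
  sides (up _)  (p , q) d0 = refl
  sides (up _)  (p , q) d1 = sym (trans p q)
  sides (up _)  (p , q) d2 = sym p
  sides (down _) (p , q) d0 = refl
  sides (down _) (p , q) d1 = p
  sides (down _) (p , q) d2 = sym q

DirectedAs⇒Directed : ∀ σ F {c} → DirectedAs σ F c → Directed σ F
DirectedAs⇒Directed σ (up _)  (directed w) = trans (w d0) (sym (w d2)) , trans (w d2) (sym (w d1))
DirectedAs⇒Directed σ (down _) (directed w) = trans (w d1) (sym (w d0)) , trans (w d0) (sym (w d2))

AlmostDirected⇒AlmostDirectedAs : ∀ σ F {e} → AlmostDirected σ F e →
  Σ (Fin 3) λ d → Σ Bool λ a → e ≡ edge F d × AlmostDirectedAs σ F d a
AlmostDirected⇒AlmostDirectedAs σ F@(up _) (inj₁ (e≡ , q , r)) =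
  d0 , flag σ F d2 , e≡ , almostDirected λ { d0 → ¬-not r ; d1 → sym q ; d2 → refl }
AlmostDirected⇒AlmostDirectedAs σ F@(up _) (inj₂ (inj₁ (e≡ , q , r))) =
  d2 , flag σ F d0 , e≡ , almostDirected λ { d0 → refl ; d1 → sym q ; d2 → ¬-not r }
AlmostDirected⇒AlmostDirectedAs σ F@(up _) (inj₂ (inj₂ (e≡ , q , r))) =
  d1 , flag σ F d0 , e≡ , almostDirected λ { d0 → refl ; d1 → ¬-not r ; d2 → sym q }
AlmostDirected⇒AlmostDirectedAs σ F@(down _) (inj₁ (e≡ , q , r)) =
  d1 , flag σ F d0 , e≡ , almostDirected λ { d0 → refl ; d1 → ¬-not r ; d2 → sym q }
AlmostDirected⇒AlmostDirectedAs σ F@(down _) (inj₂ (inj₁ (e≡ , q , r))) =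
  d0 , flag σ F d1 , e≡ , almostDirected λ { d0 → ¬-not r ; d1 → refl ; d2 → sym q }
AlmostDirected⇒AlmostDirectedAs σ F@(down _) (inj₂ (inj₂ (e≡ , q , r))) =
  d2 , flag σ F d1 , e≡ , almostDirected λ { d0 → sym q ; d1 → refl ; d2 → ¬-not r }

AlmostDirectedAs⇒AlmostDirected : ∀ σ F d {a} → AlmostDirectedAs σ F d a → AlmostDirected σ F (edge F d)
AlmostDirectedAs⇒AlmostDirected σ (up _) d0 (almostDirected w) =
  inj₁ (refl , trans (w d2) (sym (w d1)) , λ eq → not≢self (trans (sym (w d0)) (trans eq (w d2))))
AlmostDirectedAs⇒AlmostDirected σ (up _) d2 (almostDirected w) =
  inj₂ (inj₁ (refl , trans (w d0) (sym (w d1)) , λ eq → not≢self (trans (sym (w d2)) (trans eq (w d0)))))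
AlmostDirectedAs⇒AlmostDirected σ (up _) d1 (almostDirected w) =
  inj₂ (inj₂ (refl , trans (w d0) (sym (w d2)) , λ eq → not≢self (trans (sym (w d1)) (trans eq (w d0)))))
AlmostDirectedAs⇒AlmostDirected σ (down _) d1 (almostDirected w) =
  inj₁ (refl , trans (w d0) (sym (w d2)) , λ eq → not≢self (trans (sym (w d1)) (trans eq (w d0))))
AlmostDirectedAs⇒AlmostDirected σ (down _) d0 (almostDirected w) =
  inj₂ (inj₁ (refl , trans (w d1) (sym (w d2)) , λ eq → not≢self (trans (sym (w d0)) (trans eq (w d1)))))
AlmostDirectedAs⇒AlmostDirected σ (down _) d2 (almostDirected w) =
  inj₂ (inj₂ (refl , trans (w d1) (sym (w d0)) , λ eq → not≢self (trans (sym (w d2)) (trans eq (w d1)))))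

almostDirectedAs-blocking : ∀ {σ F d a} → AlmostDirectedAs σ F d a → flag σ F d ≡ not a
almostDirectedAs-blocking {d = d} {a} (almostDirected w) = trans (w d) (cong (_xor a) (dec-true (d Fin.≟ d) refl))

almostDirectedAs-unblocked : ∀ {σ F d a} → AlmostDirectedAs σ F d a → ∀ d′ → d′ ≢ d → flag σ F d′ ≡ a
almostDirectedAs-unblocked {d = d} {a} (almostDirected w) d′ d′≢d =
  trans (w d′) (cong (_xor a) (dec-false (d′ Fin.≟ d) d′≢d))

majority : Bool → Bool → Bool → Bool
majority x y z = (x ∧ y) ∨ (y ∧ z) ∨ (x ∧ z)

sense : Orientation → Face → Bool
sense σ F = majority (flag σ F d0) (flag σ F d1) (flag σ F d2)

sense-directed : ∀ {σ F c} → DirectedAs σ F c → sense σ F ≡ c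
sense-directed {c = c} (directed w) rewrite w d0 | w d1 | w d2 with c
... | true  = refl
... | false = refl

sense-almostDirected : ∀ {σ F d a} → AlmostDirectedAs σ F d a → sense σ F ≡ a
sense-almostDirected {d = d0} {a} (almostDirected w) rewrite w d0 | w d1 | w d2 with a
... | true  = refl
... | false = refl
sense-almostDirected {d = d1} {a} (almostDirected w) rewrite w d0 | w d1 | w d2 with a
... | true  = refl
... | false = refl
sense-almostDirected {d = d2} {a} (almostDirected w) rewrite w d0 | w d1 | w d2 with a
... | true  = refl
... | false = refl

directed⇒¬almostDirected : ∀ {σ F c d a} → DirectedAs σ F c → ¬ AlmostDirectedAs σ F d a
directed⇒¬almostDirected {d = d} w v =
  not≢self (trans (sym (almostDirectedAs-blocking v))
                  (trans (side w d) (trans (sym (sense-directed w)) (sense-almostDirected v))))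

almostDirectedAs-unique : ∀ {σ F d a d′ a′} → AlmostDirectedAs σ F d a → AlmostDirectedAs σ F d′ a′ → d ≡ d′
almostDirectedAs-unique {d = d} {d′ = d′} v w with d Fin.≟ d′
... | yes d≡d′ = d≡d′
... | no  d≢d′ = ⊥-elim (not≢self (trans (sym (almostDirectedAs-blocking v))
                          (trans (almostDirectedAs-unblocked w d d≢d′)
                                 (trans (sym (sense-almostDirected w)) (sense-almostDirected v)))))


odd : ℕ → Bool
odd zero    = false
odd (suc n) = not (odd n)

odd-+ : ∀ m n → odd (m ℕ.+ n) ≡ odd m xor odd n
odd-+ zero    n = refl
odd-+ (suc m) n = trans (cong not (odd-+ m n)) (not-distribˡ-xor (odd m) (odd n))

occurrences : Face → List Face → ℕ
occurrences X [] = 0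
occurrences X (Y ∷ L) with X ≟F Y
... | yes _ = suc (occurrences X L)
... | no  _ = occurrences X L

∈-removeAt : ∀ {A : Set} {x y : A} {M} (x∈M : x ∈ M) → y ∈ M → y ≢ x → y ∈ (M Any.─ x∈M)
∈-removeAt (here refl)  (here refl)  y≢x = ⊥-elim (y≢x refl)
∈-removeAt (here refl)  (there y∈M) _    = y∈M
∈-removeAt (there x∈M) (here refl)  _    = here refl
∈-removeAt (there x∈M) (there y∈M) y≢x  = there (∈-removeAt x∈M y∈M y≢x)

Unique-⊆⇒length≤ : ∀ {A : Set} {L M : List A} → Unique L → (∀ {x} → x ∈ L → x ∈ M) → length L ≤ length M
Unique-⊆⇒length≤ {L = []} _ _ = z≤n
Unique-⊆⇒length≤ {L = x ∷ L} {M} (x∉L ∷ uL) L⊆M =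
  subst (suc (length L) ≤_) (sym (ListP.length-removeAt′ M (Any.index x∈M)))
    (s≤s (Unique-⊆⇒length≤ uL λ y∈L →
      ∈-removeAt x∈M (L⊆M (there y∈L)) (λ y≡x → All.lookup x∉L y∈L (sym y≡x))))
  where
  x∈M = L⊆M (here refl)

occurrences-++ : ∀ Y L M → occurrences Y (L ++ M) ≡ occurrences Y L ℕ.+ occurrences Y M
occurrences-++ Y [] M = refl
occurrences-++ Y (Z ∷ L) M with Y ≟F Z
... | yes _ = cong suc (occurrences-++ Y L M)
... | no  _ = occurrences-++ Y L M

odd-occurrences⇒∈ : ∀ Y L → odd (occurrences Y L) ≡ true → Y ∈ L
odd-occurrences⇒∈ Y (Z ∷ L) odd≡ with Y ≟F Z
... | yes refl = here refl
... | no  _    = there (odd-occurrences⇒∈ Y L odd≡)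

∉⇒occurrences≡0 : ∀ Y L → ¬ Y ∈ L → occurrences Y L ≡ 0
∉⇒occurrences≡0 Y [] _ = refl
∉⇒occurrences≡0 Y (Z ∷ L) Y∉ with Y ≟F Z
... | yes refl = ⊥-elim (Y∉ (here refl))
... | no  _    = ∉⇒occurrences≡0 Y L (λ Y∈ → Y∉ (there Y∈))

Unique-∈⇒occurrences≡1 : ∀ Y L → Unique L → Y ∈ L → occurrences Y L ≡ 1
Unique-∈⇒occurrences≡1 Y (Z ∷ L) (Z∉L ∷ _) Y∈ with Y ≟F Z
Unique-∈⇒occurrences≡1 Y (Z ∷ L) (Z∉L ∷ _) Y∈ | yes refl =
  cong suc (∉⇒occurrences≡0 Y L (λ Y∈L → All.lookup Z∉L Y∈L refl))
Unique-∈⇒occurrences≡1 Y (Z ∷ L) _ (here refl)       | no Y≢Z = ⊥-elim (Y≢Z refl)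
Unique-∈⇒occurrences≡1 Y (Z ∷ L) (_ ∷ uL) (there Y∈) | no _   = Unique-∈⇒occurrences≡1 Y L uL Y∈

private
  indicator : Bool → ℕ
  indicator true  = 1
  indicator false = 0

count : {A : Set} → (A → Bool) → List A → ℕ
count f []       = 0
count f (x ∷ xs) = indicator (f x) ℕ.+ count f xs

length-filter-T? : {A : Set} (f : A → Bool) (xs : List A) → length (filter (λ x → T? (f x)) xs) ≡ count f xs
length-filter-T? f []       = refl
length-filter-T? f (x ∷ xs) with f x
... | true  = cong suc (length-filter-T? f xs)
... | false = length-filter-T? f xs

count-cong : {A : Set} {f g : A → Bool} → (∀ x → f x ≡ g x) → ∀ xs → count f xs ≡ count g xs
count-cong f≗g []       = refl
count-cong f≗g (x ∷ xs) = cong₂ ℕ._+_ (cong indicator (f≗g x)) (count-cong f≗g xs)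

count-split : {A : Set} (m f : A → Bool) (xs : List A) →
              count f xs ≡ count (λ x → m x ∧ f x) xs ℕ.+ count (λ x → not (m x) ∧ f x) xs
count-split m f []       = refl
count-split m f (x ∷ xs) with m x | f x | count-split m f xs
... | true  | true  | ih = cong suc ih
... | true  | false | ih = ih
... | false | true  | ih = trans (cong suc ih) (sym (ℕP.+-suc _ _))
... | false | false | ih = ih

reverseFaces-odd : ∀ σ L e → reverseFaces σ L e ≡ σ e xor odd (countFaces e L)
reverseFaces-odd σ L e = cong (σ e xor_) (%2≡ᵇ1 (countFaces e L))
  where
  %2≡ᵇ1 : ∀ n → (n ℕ.% 2 ℕ.≡ᵇ 1) ≡ odd n
  %2≡ᵇ1 zero          = refl
  %2≡ᵇ1 (suc zero)    = refl
  %2≡ᵇ1 (suc (suc n)) = trans (%2≡ᵇ1 n) (sym (not-involutive (odd n)))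

countFaces-++ : ∀ e L M → countFaces e (L ++ M) ≡ countFaces e L ℕ.+ countFaces e M
countFaces-++ e L M = trans (cong length (ListP.filter-++ (λ F → any? (e ≟E_) (edgesOf F)) L M))
                            (ListP.length-++ (filter (λ F → any? (e ≟E_) (edgesOf F)) L))

reverseFaces-++ : ∀ σ L M e → reverseFaces (reverseFaces σ L) M e ≡ reverseFaces σ (L ++ M) e
reverseFaces-++ σ L M e = begin
  reverseFaces (reverseFaces σ L) M e
    ≡⟨ reverseFaces-odd (reverseFaces σ L) M e ⟩
  reverseFaces σ L e xor odd (countFaces e M)
    ≡⟨ cong (_xor odd (countFaces e M)) (reverseFaces-odd σ L e) ⟩
  (σ e xor odd (countFaces e L)) xor odd (countFaces e M)
    ≡⟨ xor-assoc (σ e) _ _ ⟩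
  σ e xor (odd (countFaces e L) xor odd (countFaces e M))
    ≡⟨ cong (σ e xor_) (sym (trans (cong odd (countFaces-++ e L M)) (odd-+ (countFaces e L) _))) ⟩
  σ e xor odd (countFaces e (L ++ M))
    ≡⟨ sym (reverseFaces-odd σ (L ++ M) e) ⟩
  reverseFaces σ (L ++ M) e ∎
  where open ≡-Reasoning

reverseFaces-comm : ∀ σ L M e → reverseFaces (reverseFaces σ L) M e ≡ reverseFaces (reverseFaces σ M) L e
reverseFaces-comm σ L M e = begin
  reverseFaces (reverseFaces σ L) M e                  ≡⟨ reverseFaces-++ σ L M e ⟩
  σ e xor (countFaces e (L ++ M) ℕ.% 2 ℕ.≡ᵇ 1)        ≡⟨ cong (λ n → σ e xor (n ℕ.% 2 ℕ.≡ᵇ 1)) swap ⟩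
  σ e xor (countFaces e (M ++ L) ℕ.% 2 ℕ.≡ᵇ 1)        ≡⟨ reverseFaces-++ σ M L e ⟨
  reverseFaces (reverseFaces σ M) L e                  ∎
  where
  open ≡-Reasoning
  swap : countFaces e (L ++ M) ≡ countFaces e (M ++ L)
  swap = trans (countFaces-++ e L M) (trans (ℕP.+-comm (countFaces e L) _) (sym (countFaces-++ e M L)))

reverseFaces-absorb : ∀ σ L M e → reverseFaces (reverseFaces σ M) (L ++ M) e ≡ reverseFaces σ L e
reverseFaces-absorb σ L M e = begin
  reverseFaces (reverseFaces σ M) (L ++ M) e                     ≡⟨ reverseFaces-odd (reverseFaces σ M) (L ++ M) e ⟩
  reverseFaces σ M e xor odd (countFaces e (L ++ M))
    ≡⟨ cong₂ _xor_ (reverseFaces-odd σ M e) (cong odd (countFaces-++ e L M)) ⟩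
  (σ e xor odd (countFaces e M)) xor odd (countFaces e L ℕ.+ countFaces e M)
    ≡⟨ cong ((σ e xor odd (countFaces e M)) xor_) (odd-+ (countFaces e L) _) ⟩
  (σ e xor odd (countFaces e M)) xor (odd (countFaces e L) xor odd (countFaces e M))
    ≡⟨ cancel (σ e) (odd (countFaces e M)) (odd (countFaces e L)) ⟩
  σ e xor odd (countFaces e L)                                   ≡⟨ reverseFaces-odd σ L e ⟨
  reverseFaces σ L e                                             ∎
  where
  open ≡-Reasoning
  cancel : ∀ s m l → (s xor m) xor (l xor m) ≡ s xor l
  cancel true  true  true  = refl
  cancel true  true  false = refl
  cancel true  false true  = refl
  cancel true  false false = refl
  cancel false true  true  = refl
  cancel false true  false = refl
  cancel false false true  = refl
  cancel false false false = refl

reverseFaces-involutive : ∀ σ L e → reverseFaces (reverseFaces σ L) L e ≡ σ e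
reverseFaces-involutive σ L e = trans (reverseFaces-absorb σ [] L e) (xor-identityʳ (σ e))

reverseFaces≡⇒same-parity : ∀ σ L M e → reverseFaces σ L e ≡ reverseFaces σ M e →
                            odd (countFaces e L) ≡ odd (countFaces e M)
reverseFaces≡⇒same-parity σ L M e eq with σ e | trans (sym (reverseFaces-odd σ L e)) (trans eq (reverseFaces-odd σ M e))
... | false | p = p
... | true  | p = not-injective p

countFaces-edge : ∀ X d L → countFaces (edge X d) L ≡ occurrences X L ℕ.+ occurrences (neighbour X d) L
countFaces-edge X d [] = refl
countFaces-edge X d (Y ∷ L) with any? (edge X d ≟E_) (edgesOf Y) | X ≟F Y | neighbour X d ≟F Y
... | yes _ | yes refl | yes eq   = ⊥-elim (neighbour-≢ X d eq)
... | yes _ | yes refl | no _     = cong suc (countFaces-edge X d L)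
... | yes _ | no _     | yes refl =
  trans (cong suc (countFaces-edge X d L)) (sym (ℕP.+-suc (occurrences X L) (occurrences (neighbour X d) L)))
... | yes e∈Y | no X≢Y | no X′≢Y with edge∈edgesOf⇒adjacent Y X d e∈Y
...   | inj₁ Y≡X  = ⊥-elim (X≢Y (sym Y≡X))
...   | inj₂ Y≡X′ = ⊥-elim (X′≢Y (sym Y≡X′))
countFaces-edge X d (Y ∷ L) | no e∉Y | yes refl | _    = ⊥-elim (e∉Y (edge∈edgesOf X d))
countFaces-edge X d (Y ∷ L) | no e∉Y | no _ | yes refl = ⊥-elim (e∉Y (edge∈edgesOf-neighbour X d))
countFaces-edge X d (Y ∷ L) | no _   | no _ | no _     = countFaces-edge X d L

flag-reverseFaces : ∀ σ L X d →
  flag (reverseFaces σ L) X d ≡ flag σ X d xor odd (occurrences X L ℕ.+ occurrences (neighbour X d) L)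
flag-reverseFaces σ L X d = begin
  (reverseFaces σ L (edge X d) == ccw (proj₂ X) d)
    ≡⟨ cong (_== ccw (proj₂ X) d) (reverseFaces-odd σ L (edge X d)) ⟩
  ((σ (edge X d) xor odd (countFaces (edge X d) L)) == ccw (proj₂ X) d)
    ≡⟨ xor-== (σ (edge X d)) _ (ccw (proj₂ X) d) ⟩
  flag σ X d xor odd (countFaces (edge X d) L)
    ≡⟨ cong (λ n → flag σ X d xor odd n) (countFaces-edge X d L) ⟩
  flag σ X d xor odd (occurrences X L ℕ.+ occurrences (neighbour X d) L) ∎
  where open ≡-Reasoning

reverseFace-directed : ∀ σ F {c} → DirectedAs σ F c → DirectedAs (reverseFaces σ (F ∷ [])) F (not c)
reverseFace-directed σ F {c} (directed w) = directed flipped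
  where
  flipped : ∀ d → flag (reverseFaces σ (F ∷ [])) F d ≡ not c
  flipped d with flag-reverseFaces σ (F ∷ []) F d
  ... | flag≡ with F ≟F F | neighbour F d ≟F F
  ...   | no F≢F | _        = ⊥-elim (F≢F refl)
  ...   | yes _  | yes F′≡F = ⊥-elim (neighbour-≢ F d F′≡F)
  ...   | yes _  | no _     = trans flag≡ (trans (cong (_xor true) (w d)) (xor-comm c true))

flags-agree : ∀ {S σ τ F} → F ∈ S → (∀ e → InG S e → σ e ≡ τ e) → ∀ d → flag σ F d ≡ flag τ F d
flags-agree {F = F} F∈S σ≗τ d = cong (_== ccw (proj₂ F) d) (σ≗τ (edge F d) (F , F∈S , edge∈edgesOf F d))


-- Lists of faces without boundary

-- A set of faces closed under taking neighbours contains, with any face, the walk east along its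
-- row (up (i,j), down (i,j), up (i+1,j), …), whose faces are pairwise distinct: it is infinite.
private
  east : Face → Face
  east (up (i , j))  = down (i , j)
  east (down (i , j)) = up (i ℤ.+ + 1 , j)

  east-neighbour : ∀ F → Σ (Fin 3) λ d → east F ≡ neighbour F d
  east-neighbour (up _)  = d2 , refl
  east-neighbour (down _) = d1 , refl

  rank : Face → ℤ
  rank (up (i , j))  = + 2 ℤ.* (i ℤ.+ j)
  rank (down (i , j)) = + 2 ℤ.* (i ℤ.+ j) ℤ.+ + 1

  rank-east : ∀ F → rank (east F) ≡ rank F ℤ.+ + 1
  rank-east (up (i , j))  = refl
  rank-east (down (i , j)) = lemma i j
    where
    lemma : ∀ (i j : ℤ) → + 2 ℤ.* (i ℤ.+ + 1 ℤ.+ j) ≡ + 2 ℤ.* (i ℤ.+ j) ℤ.+ + 1 ℤ.+ + 1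
    lemma = solve-∀

  eastward : Face → ℕ → Face
  eastward F zero    = F
  eastward F (suc k) = east (eastward F k)

  rank-eastward : ∀ F k → rank (eastward F k) ≡ rank F ℤ.+ + k
  rank-eastward F zero    = sym (ℤP.+-identityʳ (rank F))
  rank-eastward F (suc k) = begin
    rank (east (eastward F k)) ≡⟨ rank-east (eastward F k) ⟩
    rank (eastward F k) ℤ.+ + 1 ≡⟨ cong (ℤ._+ + 1) (rank-eastward F k) ⟩
    rank F ℤ.+ + k ℤ.+ + 1      ≡⟨ ℤP.+-assoc (rank F) (+ k) (+ 1) ⟩
    rank F ℤ.+ + (k ℕ.+ 1)      ≡⟨ cong (λ n → rank F ℤ.+ + n) (ℕP.+-comm k 1) ⟩
    rank F ℤ.+ + suc k ∎
    where open ≡-Reasoning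

  eastward-injective : ∀ F {j k} → eastward F j ≡ eastward F k → j ≡ k
  eastward-injective F {j} {k} eq =
    ℤP.+-injective (ℤ+.∙-cancelˡ (rank F) (+ j) (+ k)
                     (trans (sym (rank-eastward F j)) (trans (cong rank eq) (rank-eastward F k))))

no-neighbour-closed-subset : ∀ (S : List Face) (P : Face → Set) → (∀ {Y} → P Y → Y ∈ S) →
                             (∀ {X} d → P X → P (neighbour X d)) → ∀ Y → ¬ P Y
no-neighbour-closed-subset S P P⊆S closed Y PY =
  ℕP.<-irrefl refl (subst (ℕ._≤ length S) (ListP.length-applyUpTo (eastward Y) (suc (length S)))
    (Unique-⊆⇒length≤ (Unique.applyUpTo⁺₁ (eastward Y) _ λ i<j _ eq → ℕP.<⇒≢ i<j (eastward-injective Y eq))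
                      walk⊆S))
  where
  P-eastward : ∀ k → P (eastward Y k)
  P-eastward zero    = PY
  P-eastward (suc k) with east-neighbour (eastward Y k)
  ... | d , eq = subst P (sym eq) (closed d (P-eastward k))
  walk⊆S : ∀ {F} → F ∈ applyUpTo (eastward Y) (suc (length S)) → F ∈ S
  walk⊆S F∈ with ∈-applyUpTo⁻ (eastward Y) F∈
  ... | k , _ , refl = P⊆S (P-eastward k)

evenly-covered⇒even : ∀ (S K : List Face) → (∀ {Y} → Y ∈ K → Y ∈ S) →
                      (∀ {X} → X ∈ S → ∀ d → odd (countFaces (edge X d) K) ≡ false) →
                      ∀ Y → odd (occurrences Y K) ≡ false
evenly-covered⇒even S K K⊆S covered Y = ¬-not (no-neighbour-closed-subset S P P⊆S closed Y)
  where
  P : Face → Set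
  P Y = odd (occurrences Y K) ≡ true
  P⊆S : ∀ {Y} → P Y → Y ∈ S
  P⊆S {Y} PY = K⊆S (odd-occurrences⇒∈ Y K PY)
  closed : ∀ {X} d → P X → P (neighbour X d)
  closed {X} d PX = not-injective (begin
    not (odd (occurrences (neighbour X d) K))           ≡⟨ cong (_xor odd (occurrences (neighbour X d) K)) (sym PX) ⟩
    odd (occurrences X K) xor odd (occurrences (neighbour X d) K) ≡⟨ sym (odd-+ (occurrences X K) _) ⟩
    odd (occurrences X K ℕ.+ occurrences (neighbour X d) K)       ≡⟨ cong odd (sym (countFaces-edge X d K)) ⟩
    odd (countFaces (edge X d) K)                       ≡⟨ covered (P⊆S PX) d ⟩
    false                                               ∎)
    where open ≡-Reasoning


-- Flip sequences

flips : ∀ {S n σ τ} → Path S n σ τ → List Face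
flips (here _)                    = []
flips (flipFace {F = F} _ _ p)    = F ∷ flips p

length-flips : ∀ {S n σ τ} (p : Path S n σ τ) → length (flips p) ≡ n
length-flips (here _)         = refl
length-flips (flipFace _ _ p) = cong suc (length-flips p)

flips⊆S : ∀ {S n σ τ} (p : Path S n σ τ) → ∀ {Y} → Y ∈ flips p → Y ∈ S
flips⊆S (flipFace F∈S _ p) (here refl) = F∈S
flips⊆S (flipFace _ _ p)   (there Y∈)  = flips⊆S p Y∈

path-endpoint : ∀ {S n σ τ} (p : Path S n σ τ) → ∀ e → InG S e → τ e ≡ reverseFaces σ (flips p) e
path-endpoint {σ = σ} (here σ≗τ) e e∈G = trans (sym (σ≗τ e e∈G)) (sym (xor-identityʳ (σ e)))
path-endpoint {σ = σ} (flipFace {F = F} _ _ p) e e∈G =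
  trans (path-endpoint p e e∈G) (reverseFaces-++ σ (F ∷ []) (flips p) e)

-- Every face of K is flipped an odd number of times: the list of flips followed by K covers each
-- edge of G an even number of times, hence each face as well.
length≤path : ∀ {S n σ τ} (p : Path S n σ τ) (K : List Face) → Unique K → (∀ {Y} → Y ∈ K → Y ∈ S) →
              (∀ e → InG S e → τ e ≡ reverseFaces σ K e) → length K ≤ n
length≤path {S} {σ = σ} p K uK K⊆S τ≡ = subst (length K ≤_) (length-flips p) (Unique-⊆⇒length≤ uK K⊆flips)
  where
  fl = flips p
  fl++K⊆S : ∀ {Y} → Y ∈ fl ++ K → Y ∈ S
  fl++K⊆S Y∈ with ∈-++⁻ fl Y∈
  ... | inj₁ Y∈fl = flips⊆S p Y∈fl
  ... | inj₂ Y∈K  = K⊆S Y∈K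
  covered : ∀ {X} → X ∈ S → ∀ d → odd (countFaces (edge X d) (fl ++ K)) ≡ false
  covered {X} X∈S d = begin
    odd (countFaces e (fl ++ K))                   ≡⟨ cong odd (countFaces-++ e fl K) ⟩
    odd (countFaces e fl ℕ.+ countFaces e K)       ≡⟨ odd-+ (countFaces e fl) _ ⟩
    odd (countFaces e fl) xor odd (countFaces e K) ≡⟨ cong (_xor odd (countFaces e K)) same-parity ⟩
    odd (countFaces e K) xor odd (countFaces e K)  ≡⟨ xor-same (odd (countFaces e K)) ⟩
    false                                          ∎
    where
    open ≡-Reasoning
    e = edge X d
    e∈G : InG S e
    e∈G = X , X∈S , edge∈edgesOf X d
    same-parity : odd (countFaces e fl) ≡ odd (countFaces e K)
    same-parity = reverseFaces≡⇒same-parity σ fl K e (trans (sym (path-endpoint p e e∈G)) (τ≡ e e∈G))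
  K⊆flips : ∀ {Y} → Y ∈ K → Y ∈ fl
  K⊆flips {Y} Y∈K = odd-occurrences⇒∈ Y fl (odd≡true (odd (occurrences Y fl)) (begin
    odd (occurrences Y fl) xor true
      ≡⟨ cong (λ n → odd (occurrences Y fl) xor odd n) (Unique-∈⇒occurrences≡1 Y K uK Y∈K) ⟨
    odd (occurrences Y fl) xor odd (occurrences Y K)
      ≡⟨ odd-+ (occurrences Y fl) _ ⟨
    odd (occurrences Y fl ℕ.+ occurrences Y K)
      ≡⟨ cong odd (occurrences-++ Y fl K) ⟨
    odd (occurrences Y (fl ++ K))
      ≡⟨ evenly-covered⇒even S (fl ++ K) fl++K⊆S covered Y ⟩
    false ∎))
    where
    open ≡-Reasoning
    odd≡true : ∀ x → x xor true ≡ false → x ≡ true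
    odd≡true true  _ = refl
    odd≡true false ()

path-respects-start : ∀ {S n σ σ′ τ} → (∀ e → InG S e → σ e ≡ σ′ e) → Path S n σ′ τ → Path S n σ τ
path-respects-start σ≗σ′ (here σ′≗τ) = here (λ e e∈G → trans (σ≗σ′ e e∈G) (σ′≗τ e e∈G))
path-respects-start {σ = σ} {σ′} σ≗σ′ (flipFace {F = F} F∈S F-dir p) =
  flipFace F∈S (DirectedAs⇒Directed σ F
                 (directed λ d → trans (flags-agree F∈S σ≗σ′ d) (side (Directed⇒DirectedAs σ′ F F-dir) d)))
    (path-respects-start (λ e e∈G → trans (reverseFaces-odd σ (F ∷ []) e)
                                   (trans (cong (_xor _) (σ≗σ′ e e∈G)) (sym (reverseFaces-odd σ′ (F ∷ []) e)))) p)

path-++ : ∀ {S m n σ τ ρ} → Path S m σ τ → Path S n τ ρ → Path S (m ℕ.+ n) σ ρ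
path-++ (here σ≗τ)       q = path-respects-start σ≗τ q
path-++ (flipFace F∈S F-dir p) q = flipFace F∈S F-dir (path-++ p q)

distance-by-parity : ∀ S (d : Orientation → Orientation → ℕ) → IsDistFn S d → ∀ {σ τ} → IsEO S σ → IsEO S τ →
                     (K : List Face) → Unique K → (∀ {Y} → Y ∈ K → Y ∈ S) →
                     (∀ e → InG S e → τ e ≡ reverseFaces σ K e) → Path S (length K) σ τ → d σ τ ≡ length K
distance-by-parity S d dist {σ} {τ} eoσ eoτ K uK K⊆S τ≡ p =
  ℕP.≤-antisym (proj₂ (dist σ τ eoσ eoτ) (length K) p) (length≤path (proj₁ (dist σ τ eoσ eoτ)) K uK K⊆S τ≡)


-- Height functions

sign : Bool → ℤ
sign true  = + 1
sign false = -[1+ 0 ]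

private
  atFace : Face → Face → ℤ → ℤ
  atFace Y F z with Y ≟F F
  ... | yes _ = z
  ... | no  _ = + 0

  sign-leaving : ∀ c → sign (c xor true) ≡ sign c ℤ.+ + 2 ℤ.* (+ 0 ℤ.- sign c)
  sign-leaving true  = refl
  sign-leaving false = refl

  sign-entering : ∀ f → sign (f xor true) ≡ sign f ℤ.+ + 2 ℤ.* (sign (not f) ℤ.- + 0)
  sign-entering true  = refl
  sign-entering false = refl

-- Each flip of Y counts with the sign of its sense before the flip; for a directed face that is flag σ F d0.
netFlips : ∀ {S n σ τ} → Path S n σ τ → Face → ℤ
netFlips (here _)                         Y = + 0
netFlips (flipFace {σ = σ} {F = F} _ _ p) Y = atFace Y F (sign (flag σ F d0)) ℤ.+ netFlips p Y

sign-flag-reverseFace : ∀ σ F {c} → DirectedAs σ F c → ∀ X d →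
  sign (flag (reverseFaces σ (F ∷ [])) X d)
    ≡ sign (flag σ X d) ℤ.+ + 2 ℤ.* (atFace (neighbour X d) F (sign c) ℤ.- atFace X F (sign c))
sign-flag-reverseFace σ F {c} (directed w) X d with flag-reverseFaces σ (F ∷ []) X d
... | flag≡ with X ≟F F | neighbour X d ≟F F
... | yes refl | yes X′≡X = ⊥-elim (neighbour-≢ X d X′≡X)
... | yes refl | no _ rewrite flag≡ | w d = sign-leaving c
... | no _ | no _ rewrite flag≡ | xor-identityʳ (flag σ X d) = sym (ℤP.+-identityʳ (sign (flag σ X d)))
... | no _ | yes refl rewrite flag≡ | trans (sym (w d)) (flag-neighbour σ X d) = sign-entering (flag σ X d)

sign-flag-path : ∀ {S n σ τ} (p : Path S n σ τ) → ∀ X d → InG S (edge X d) →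
  sign (flag τ X d) ≡ sign (flag σ X d) ℤ.+ + 2 ℤ.* (netFlips p (neighbour X d) ℤ.- netFlips p X)
sign-flag-path {σ = σ} (here σ≗τ) X d e∈G =
  trans (cong (λ b → sign (b == ccw (proj₂ X) d)) (sym (σ≗τ (edge X d) e∈G)))
        (sym (ℤP.+-identityʳ (sign (flag σ X d))))
sign-flag-path {σ = σ} {τ} (flipFace {F = F} _ F-dir p) X d e∈G = begin
  sign (flag τ X d)
    ≡⟨ sign-flag-path p X d e∈G ⟩
  sign (flag σ′ X d) ℤ.+ + 2 ℤ.* (netFlips p X′ ℤ.- netFlips p X)
    ≡⟨ cong (ℤ._+ + 2 ℤ.* (netFlips p X′ ℤ.- netFlips p X))
            (sign-flag-reverseFace σ F (Directed⇒DirectedAs σ F F-dir) X d) ⟩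
  sign (flag σ X d) ℤ.+ + 2 ℤ.* (atFace X′ F s ℤ.- atFace X F s) ℤ.+ + 2 ℤ.* (netFlips p X′ ℤ.- netFlips p X)
    ≡⟨ regroup (sign (flag σ X d)) (atFace X′ F s) (atFace X F s) (netFlips p X′) (netFlips p X) ⟩
  sign (flag σ X d) ℤ.+ + 2 ℤ.* ((atFace X′ F s ℤ.+ netFlips p X′) ℤ.- (atFace X F s ℤ.+ netFlips p X)) ∎
  where
  open ≡-Reasoning
  σ′ = reverseFaces σ (F ∷ [])
  X′ = neighbour X d
  s = sign (flag σ F d0)
  regroup : ∀ (f a b x y : ℤ) →
            f ℤ.+ + 2 ℤ.* (a ℤ.- b) ℤ.+ + 2 ℤ.* (x ℤ.- y) ≡ f ℤ.+ + 2 ℤ.* ((a ℤ.+ x) ℤ.- (b ℤ.+ y))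
  regroup = solve-∀

IsHeight : List Face → Orientation → (Face → ℤ) → Set
IsHeight S σ h = ∀ X d → InG S (edge X d) → h X ≡ h (neighbour X d) ℤ.+ sign (flag σ X d)

-- A flip sequence from σ to its reversal turns every side around, so its net flip counts
-- change by exactly one across each edge.
reversal⇒height : ∀ {S n σ} (p : Path S n σ (λ e → not (σ e))) → IsHeight S σ (netFlips p)
reversal⇒height {σ = σ} p X d e∈G =
  solve-height (netFlips p (neighbour X d)) (netFlips p X) (sign (flag σ X d))
    (trans (sym (sign-not (flag σ X d))) (trans (cong sign (sym (not-== (σ (edge X d)) (ccw (proj₂ X) d))))
                                               (sign-flag-path p X d e∈G)))
  where
  sign-not : ∀ b → sign (not b) ≡ ℤ.- sign b
  sign-not true  = refl
  sign-not false = refl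
  solve-height : ∀ (a b s : ℤ) → ℤ.- s ≡ s ℤ.+ + 2 ℤ.* (a ℤ.- b) → b ≡ a ℤ.+ s
  solve-height a b s eq = ℤP.*-cancelˡ-≡ (+ 2) b (a ℤ.+ s) (begin
    + 2 ℤ.* b                                                   ≡⟨ expand a b s ⟩
    + 2 ℤ.* (a ℤ.+ s) ℤ.- (s ℤ.+ + 2 ℤ.* (a ℤ.- b)) ℤ.+ ℤ.- s   ≡⟨ cong (λ z → + 2 ℤ.* (a ℤ.+ s) ℤ.- z ℤ.+ ℤ.- s) eq ⟨
    + 2 ℤ.* (a ℤ.+ s) ℤ.- ℤ.- s ℤ.+ ℤ.- s                       ≡⟨ collapse (a ℤ.+ s) s ⟩
    + 2 ℤ.* (a ℤ.+ s)                                           ∎)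
    where
    open ≡-Reasoning
    expand : ∀ (a b s : ℤ) → + 2 ℤ.* b ≡ + 2 ℤ.* (a ℤ.+ s) ℤ.- (s ℤ.+ + 2 ℤ.* (a ℤ.- b)) ℤ.+ ℤ.- s
    expand = solve-∀
    collapse : ∀ (x s : ℤ) → + 2 ℤ.* x ℤ.- ℤ.- s ℤ.+ ℤ.- s ≡ + 2 ℤ.* x
    collapse = solve-∀


-- Eulerian orientations

-- x is a slot of incident v; out σ x says that σ directs its edge away from v.
out : Orientation → Edge × Bool → Bool
out σ (e , a) = σ e == a

balanced-at : List Face → Orientation → Vertex → Set
balanced-at S σ v = count (λ x → inGᵇ S (proj₁ x) ∧ out σ x) (incident v)
                  ≡ count (λ x → inGᵇ S (proj₁ x) ∧ not (out σ x)) (incident v)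

IsEO⇒balanced : ∀ S σ → IsEO S σ → ∀ v → balanced-at S σ v
IsEO⇒balanced S σ eo v = trans (sym (length-filter-T? (λ x → inGᵇ S (proj₁ x) ∧ out σ x) (incident v)))
                        (trans (eo v) (length-filter-T? (λ x → inGᵇ S (proj₁ x) ∧ not (out σ x)) (incident v)))

balanced⇒IsEO : ∀ S σ → (∀ v → balanced-at S σ v) → IsEO S σ
balanced⇒IsEO S σ bal v = trans (length-filter-T? (λ x → inGᵇ S (proj₁ x) ∧ out σ x) (incident v))
                        (trans (bal v) (sym (length-filter-T? (λ x → inGᵇ S (proj₁ x) ∧ not (out σ x)) (incident v))))

inGᵇ⇒InG : ∀ S e → inGᵇ S e ≡ true → InG S e
inGᵇ⇒InG S e eq with any? (λ F → any? (e ≟E_) (edgesOf F)) S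
... | yes e∈ = witness e∈
  where
  witness : ∀ {S} → Any.Any (λ F → e ∈ edgesOf F) S → InG S e
  witness (here e∈F) = _ , here refl , e∈F
  witness (there e∈) with witness e∈
  ... | F , F∈S , e∈F = F , there F∈S , e∈F
... | no _ with eq
... | ()

InG⇒inGᵇ : ∀ S e → InG S e → inGᵇ S e ≡ true
InG⇒inGᵇ S e (F , F∈S , e∈F) =
  dec-true (any? (λ F → any? (e ≟E_) (edgesOf F)) S) (Any.map (λ { refl → e∈F }) F∈S)

IsEO-cong : ∀ S {σ τ} → IsEO S σ → (∀ e → InG S e → σ e ≡ τ e) → IsEO S τ
IsEO-cong S {σ} {τ} eo σ≗τ = balanced⇒IsEO S τ λ v →
  trans (sym (count-cong (agree (λ b → b)) (incident v)))
        (trans (IsEO⇒balanced S σ eo v) (count-cong (agree not) (incident v)))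
  where
  agree : ∀ (f : Bool → Bool) x → (inGᵇ S (proj₁ x) ∧ f (out σ x)) ≡ (inGᵇ S (proj₁ x) ∧ f (out τ x))
  agree f (e , a) with inGᵇ S e in e∈G
  ... | false = refl
  ... | true  = cong (λ b → f (b == a)) (σ≗τ e (inGᵇ⇒InG S e e∈G))

IsEO-reverse : ∀ S σ → IsEO S σ → IsEO S (λ e → not (σ e))
IsEO-reverse S σ eo = balanced⇒IsEO S (λ e → not (σ e)) λ v →
  trans (count-cong (λ x → cong (inGᵇ S (proj₁ x) ∧_) (out-not x)) (incident v))
        (trans (sym (IsEO⇒balanced S σ eo v))
               (count-cong (λ x → cong (inGᵇ S (proj₁ x) ∧_) (trans (sym (not-involutive _)) (cong not (sym (out-not x)))))
                           (incident v)))
  where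
  out-not : ∀ x → out (λ e → not (σ e)) x ≡ not (out σ x)
  out-not (e , a) = not-== (σ e) a

private
  onFace : Face → Edge × Bool → Bool
  onFace F x = edgeOfᵇ (proj₁ x) F

  -- ccwOut F x: going counterclockwise around F leaves v along the slot x of incident v.
  ccwOut : Face → Edge × Bool → Bool
  ccwOut F (e , a) = ccw (proj₂ F) (proj₂ e) == a

  ⊖≡⇔≡⊕ : ∀ v s w → v ⊖ s ≡ w ⇔ v ≡ w ⊕ s
  ⊖≡⇔≡⊕ (a , b) (c , d) (x , y) =
    mk⇔ (λ { refl → cong₂ _,_ (sub-add a c) (sub-add b d) }) (λ { refl → cong₂ _,_ (add-sub x c) (add-sub y d) })
    where
    sub-add : ∀ (a c : ℤ) → a ≡ a ℤ.- c ℤ.+ c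
    sub-add = solve-∀
    add-sub : ∀ (x c : ℤ) → x ℤ.+ c ℤ.- c ≡ x
    add-sub = solve-∀

  retarget : ∀ {v w w′ : Vertex} → w ≡ w′ → v ≡ w ⇔ v ≡ w′
  retarget refl = mk⇔ (λ p → p) (λ p → p)

  same-slot : ∀ F w d w′ d′ → (w ≡ proj₁ (edge F d) ⇔ w′ ≡ proj₁ (edge F d′)) →
              edgeOfᵇ (w , d) F ≡ edgeOfᵇ (w′ , d′) F
  same-slot F w d w′ d′ w⇔w′ = does-⇔ (⇔-sym (∈edgesOf⇔ F) ⇔-∘ (w⇔w′ ⇔-∘ ∈edgesOf⇔ F))
                                      (any? ((w , d) ≟E_) (edgesOf F)) (any? ((w′ , d′) ≟E_) (edgesOf F))

  sum-cong : ∀ {a a′ b b′ c c′} → a ≡ a′ → b ≡ b′ → c ≡ c′ →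
             indicator a ℕ.+ (indicator b ℕ.+ (indicator c ℕ.+ 0))
               ≡ indicator a′ ℕ.+ (indicator b′ ℕ.+ (indicator c′ ℕ.+ 0))
  sum-cong refl refl refl = refl

  sum-rotate : ∀ {a a′ b b′ c c′} → a ≡ a′ → b ≡ b′ → c ≡ c′ →
               indicator a ℕ.+ (indicator b ℕ.+ (indicator c ℕ.+ 0))
                 ≡ indicator b′ ℕ.+ (indicator c′ ℕ.+ (indicator a′ ℕ.+ 0))
  sum-rotate {a} {b = b} {c = c} refl refl refl = rotate (indicator a) (indicator b) (indicator c)
    where
    rotate : ∀ x y z → x ℕ.+ (y ℕ.+ (z ℕ.+ 0)) ≡ y ℕ.+ (z ℕ.+ (x ℕ.+ 0))
    rotate = solve-ℕ

-- Every corner v of a triangle is left by exactly as many of its sides as enter it (one each),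
-- going counterclockwise; the six slots of incident v are matched up by corner.
corners-balanced : ∀ F v → count (λ x → ccwOut F x ∧ onFace F x) (incident v)
                         ≡ count (λ x → not (ccwOut F x) ∧ onFace F x) (incident v)
corners-balanced F@(up (i , j)) v = sum-cong
  (same-slot F v d0 v d1 (mk⇔ (λ p → p) (λ p → p)))
  (same-slot F (v ⊖ step d1) d1 v d2
     (retarget (cong (_, j ℤ.+ + 1) (ℤP.+-identityʳ i)) ⇔-∘ ⊖≡⇔≡⊕ v (step d1) (i , j)))
  (same-slot F (v ⊖ step d2) d2 (v ⊖ step d0) d0
     (⇔-sym (⊖≡⇔≡⊕ v (step d0) (i , j))
        ⇔-∘ (retarget (cong (i ℤ.+ + 1 ,_) (corner j)) ⇔-∘ ⊖≡⇔≡⊕ v (step d2) (i , j ℤ.+ + 1))))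
  where
  corner : ∀ (j : ℤ) → j ℤ.+ + 1 ℤ.+ -[1+ 0 ] ≡ j ℤ.+ + 0
  corner = solve-∀
corners-balanced F@(down (i , j)) v = sum-rotate
  (same-slot F v d1 (v ⊖ step d2) d2
     (⇔-sym (⊖≡⇔≡⊕ v (step d2) (i , j ℤ.+ + 1)) ⇔-∘ retarget (cong (_ ,_) (corner j))))
  (same-slot F v d2 v d0 (mk⇔ (λ p → p) (λ p → p)))
  (same-slot F (v ⊖ step d0) d0 (v ⊖ step d1) d1
     (⇔-sym (⊖≡⇔≡⊕ v (step d1) (i ℤ.+ + 1 , j))
        ⇔-∘ (retarget opposite ⇔-∘ ⊖≡⇔≡⊕ v (step d0) (i , j ℤ.+ + 1))))
  where
  corner : ∀ (j : ℤ) → j ≡ j ℤ.+ + 1 ℤ.+ -[1+ 0 ]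
  corner = solve-∀
  opposite : (i ℤ.+ + 1 , j ℤ.+ + 1 ℤ.+ + 0) ≡ (i ℤ.+ + 1 ℤ.+ + 0 , j ℤ.+ + 1)
  opposite = cong₂ _,_ (sym (ℤP.+-identityʳ _)) (ℤP.+-identityʳ _)

private
  ==-regroup : ∀ x k a → (x == a) ≡ ((x == k) == (k == a))
  ==-regroup true  true  true  = refl
  ==-regroup true  true  false = refl
  ==-regroup true  false true  = refl
  ==-regroup true  false false = refl
  ==-regroup false true  true  = refl
  ==-regroup false true  false = refl
  ==-regroup false false true  = refl
  ==-regroup false false false = refl

  out-directed : ∀ σ F {c} → DirectedAs σ F c → ∀ x → onFace F x ≡ true → out σ x ≡ (c == ccwOut F x)
  out-directed σ F (directed w) (e , a) on with any? (e ≟E_) (edgesOf F)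
  ... | no _ with on
  ...   | ()
  out-directed σ F {c} (directed w) (e , a) on | yes e∈F = begin
    (σ e == a)                    ≡⟨ ==-regroup (σ e) k a ⟩
    ((σ e == k) == (k == a))      ≡⟨ cong (λ e′ → (σ e′ == k) == (k == a)) (sym (∈edgesOf⇒edge F e∈F)) ⟩
    (flag σ F (proj₂ e) == (k == a)) ≡⟨ cong (_== (k == a)) (w (proj₂ e)) ⟩
    (c == (k == a))                 ∎
    where
    open ≡-Reasoning
    k = ccw (proj₂ F) (proj₂ e)

face-balanced : ∀ σ F {c} → DirectedAs σ F c → ∀ v →
  count (λ x → onFace F x ∧ out σ x) (incident v) ≡ count (λ x → onFace F x ∧ not (out σ x)) (incident v)
face-balanced σ F {c} w v = begin
  count (λ x → onFace F x ∧ out σ x) (incident v)             ≡⟨ count-cong (via (λ b → b)) (incident v) ⟩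
  count (λ x → (c == ccwOut F x) ∧ onFace F x) (incident v)       ≡⟨ by-sense c ⟩
  count (λ x → not (c == ccwOut F x) ∧ onFace F x) (incident v)   ≡⟨ count-cong (via not) (incident v) ⟨
  count (λ x → onFace F x ∧ not (out σ x)) (incident v)       ∎
  where
  open ≡-Reasoning
  via : ∀ (f : Bool → Bool) x → (onFace F x ∧ f (out σ x)) ≡ (f (c == ccwOut F x) ∧ onFace F x)
  via f x with onFace F x in on
  ... | true  = trans (cong f (out-directed σ F w x on)) (sym (∧-identityʳ _))
  ... | false = sym (∧-zeroʳ _)
  by-sense : ∀ c → count (λ x → (c == ccwOut F x) ∧ onFace F x) (incident v)
                 ≡ count (λ x → not (c == ccwOut F x) ∧ onFace F x) (incident v)
  by-sense true  = trans (count-cong (λ x → cong (_∧ onFace F x) (not-involutive (ccwOut F x))) (incident v))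
                         (trans (corners-balanced F v)
                                (count-cong (λ x → cong (λ b → not b ∧ onFace F x) (sym (not-involutive (ccwOut F x))))
                                            (incident v)))
  by-sense false = trans (sym (corners-balanced F v))
                         (count-cong (λ x → cong (_∧ onFace F x) (sym (not-involutive (ccwOut F x)))) (incident v))

out-reverseFace : ∀ σ F x → out (reverseFaces σ (F ∷ [])) x ≡ out σ x xor onFace F x
out-reverseFace σ F (e , a) with any? (e ≟E_) (edgesOf F)
... | yes _ = xor-== (σ e) true a
... | no  _ = xor-== (σ e) false a

-- At each vertex the slots on sides of F are balanced before and after the reversal (face-balanced),
-- so the other slots of G are balanced as well, and they are not affected.
IsEO-reverseFace : ∀ {S σ F c} → IsEO S σ → F ∈ S → DirectedAs σ F c → IsEO S (reverseFaces σ (F ∷ []))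
IsEO-reverseFace {S} {σ} {F} eo F∈S w = balanced⇒IsEO S σ′ λ v → begin
  count (λ x → g x ∧ out σ′ x) (incident v)          ≡⟨ split-flipped (λ b → b) v ⟩
  count (λ x → m x ∧ not (o x)) (incident v) ℕ.+ A v ≡⟨ cong₂ ℕ._+_ (sym (face-balanced σ F w v)) (off-face-balanced v) ⟩
  count (λ x → m x ∧ o x) (incident v) ℕ.+ B v
    ≡⟨ cong (ℕ._+ B v) (count-cong (λ x → cong (m x ∧_) (sym (not-involutive (o x)))) (incident v)) ⟩
  count (λ x → m x ∧ not (not (o x))) (incident v) ℕ.+ B v ≡⟨ split-flipped not v ⟨
  count (λ x → g x ∧ not (out σ′ x)) (incident v)    ∎
  where
  open ≡-Reasoning
  σ′ = reverseFaces σ (F ∷ [])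
  g m o : Edge × Bool → Bool
  g x = inGᵇ S (proj₁ x)
  m = onFace F
  o = out σ
  A B : Vertex → ℕ
  A v = count (λ x → not (m x) ∧ (g x ∧ o x)) (incident v)
  B v = count (λ x → not (m x) ∧ (g x ∧ not (o x))) (incident v)

  m⇒g : ∀ x → m x ≡ true → g x ≡ true
  m⇒g (e , _) on with any? (e ≟E_) (edgesOf F)
  ... | yes e∈F = InG⇒inGᵇ S e (F , F∈S , e∈F)
  ... | no  _ with on
  ...   | ()

  on-face : ∀ (f : Bool → Bool) x → (m x ∧ (g x ∧ f (o x))) ≡ (m x ∧ f (o x))
  on-face f x with m x in on
  ... | true  rewrite m⇒g x on = refl
  ... | false = refl

  flipped-on : ∀ (f : Bool → Bool) x → (m x ∧ (g x ∧ f (out σ′ x))) ≡ (m x ∧ f (not (o x)))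
  flipped-on f x rewrite out-reverseFace σ F x with m x in on
  ... | true  rewrite m⇒g x on = cong f (xor-comm (o x) true)
  ... | false = refl

  flipped-off : ∀ (f : Bool → Bool) x → (not (m x) ∧ (g x ∧ f (out σ′ x))) ≡ (not (m x) ∧ (g x ∧ f (o x)))
  flipped-off f x rewrite out-reverseFace σ F x with m x
  ... | true  = refl
  ... | false = cong (λ b → g x ∧ f b) (xor-identityʳ (o x))

  split-flipped : ∀ (f : Bool → Bool) v →
    count (λ x → g x ∧ f (out σ′ x)) (incident v)
      ≡ count (λ x → m x ∧ f (not (o x))) (incident v) ℕ.+ count (λ x → not (m x) ∧ (g x ∧ f (o x))) (incident v)
  split-flipped f v = trans (count-split m (λ x → g x ∧ f (out σ′ x)) (incident v))
                            (cong₂ ℕ._+_ (count-cong (flipped-on f) (incident v)) (count-cong (flipped-off f) (incident v)))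

  split-original : ∀ (f : Bool → Bool) v →
    count (λ x → g x ∧ f (o x)) (incident v)
      ≡ count (λ x → m x ∧ f (o x)) (incident v) ℕ.+ count (λ x → not (m x) ∧ (g x ∧ f (o x))) (incident v)
  split-original f v = trans (count-split m (λ x → g x ∧ f (o x)) (incident v))
                             (cong (ℕ._+ count (λ x → not (m x) ∧ (g x ∧ f (o x))) (incident v))
                                   (count-cong (on-face f) (incident v)))

  off-face-balanced : ∀ v → A v ≡ B v
  off-face-balanced v = ℕP.+-cancelˡ-≡ (count (λ x → m x ∧ o x) (incident v)) (A v) (B v) (begin
    count (λ x → m x ∧ o x) (incident v) ℕ.+ A v       ≡⟨ split-original (λ b → b) v ⟨
    count (λ x → g x ∧ o x) (incident v)               ≡⟨ IsEO⇒balanced S σ eo v ⟩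
    count (λ x → g x ∧ not (o x)) (incident v)         ≡⟨ split-original not v ⟩
    count (λ x → m x ∧ not (o x)) (incident v) ℕ.+ B v ≡⟨ cong (ℕ._+ B v) (face-balanced σ F w v) ⟨
    count (λ x → m x ∧ o x) (incident v) ℕ.+ B v       ∎)

unflip : ∀ {S τ X c} → IsEO S τ → X ∈ S → DirectedAs τ X c →
         Path S 1 (reverseFaces τ (X ∷ [])) τ × IsEO S (reverseFaces τ (X ∷ []))
unflip {τ = τ} {X} eo X∈S w =
  flipFace X∈S (DirectedAs⇒Directed _ X (reverseFace-directed τ X w)) (here λ e _ → reverseFaces-involutive τ (X ∷ []) e) ,
  IsEO-reverseFace eo X∈S w


-- Towers

module Towers (S : List Face) (σ : Orientation) where

  tower-step : ∀ {F F′ e} → AlmostDirected σ F e → e ∈ edgesOf F′ → F′ ≢ F →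
               Σ (Fin 3) λ d → Σ Bool λ a → AlmostDirectedAs σ F d a × F′ ≡ neighbour F d
  tower-step {F} {F′} ad e∈F′ F′≢F with AlmostDirected⇒AlmostDirectedAs σ F ad
  ... | d , a , refl , v with edge∈edgesOf⇒adjacent F′ F d e∈F′
  ...   | inj₁ F′≡F = ⊥-elim (F′≢F F′≡F)
  ...   | inj₂ F′≡next = d , a , v , F′≡next

  tower⊆S : ∀ {X L} → Tower S σ X L → ∀ {Y} → Y ∈ L → Y ∈ S
  tower⊆S (top X∈S _)          (here refl) = X∈S
  tower⊆S (next X∈S _ _ _ _)   (here refl) = X∈S
  tower⊆S (next _ _ _ _ tw)    (there Y∈)  = tower⊆S tw Y∈

  tower-directed : ∀ {X L c} → DirectedAs σ X c → Tower S σ X L → L ≡ X ∷ []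
  tower-directed w (top _ _) = refl
  tower-directed w (next _ ad e∈ ne _) with tower-step ad e∈ ne
  ... | d , a , v , _ = ⊥-elim (directed⇒¬almostDirected w v)

  -- A tower cannot return across the edge it has just crossed: the two faces would keep
  -- blocking each other and the tower would never reach a directed face.
  no-return : ∀ {X L d a a′} → AlmostDirectedAs σ X d a → AlmostDirectedAs σ (neighbour X d) d a′ → ¬ Tower S σ X L
  no-return v w (top _ X-dir) = directed⇒¬almostDirected (Directed⇒DirectedAs σ _ X-dir) v
  no-return {X} {d = d} v w (next _ ad e∈ ne tw) with tower-step ad e∈ ne
  ... | d′ , a″ , v′ , refl with almostDirectedAs-unique v′ v
  ...   | refl = no-return w (subst (λ Y → AlmostDirectedAs σ Y d _) (sym (neighbour-involutive X d)) v) tw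

  tower-step-sense : ∀ {X L d a} → AlmostDirectedAs σ X d a → Tower S σ (neighbour X d) L → sense σ (neighbour X d) ≡ a
  tower-step-sense {X} {d = d} {a} v tw = go tw
    where
    crossed : flag σ (neighbour X d) d ≡ a
    crossed = trans (flag-neighbour σ X d) (trans (cong not (almostDirectedAs-blocking v)) (not-involutive a))
    go : ∀ {L} → Tower S σ (neighbour X d) L → sense σ (neighbour X d) ≡ a
    go (top _ dir) = trans (sense-directed w) (trans (sym (side w d)) crossed)
      where w = Directed⇒DirectedAs σ _ dir
    go t@(next _ ad e∈ ne _) with tower-step ad e∈ ne
    ... | d′ , a′ , v′ , refl with d Fin.≟ d′
    ...   | yes refl = ⊥-elim (no-return v′ (subst (λ Y → AlmostDirectedAs σ Y d a) (sym (neighbour-involutive X d)) v) t)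
    ...   | no d≢d′ = trans (sense-almostDirected v′) (trans (sym (almostDirectedAs-unblocked v′ d d≢d′)) crossed)

  tower-sense : ∀ {X L Y} → Tower S σ X L → Y ∈ L → sense σ Y ≡ sense σ X
  tower-sense (top _ _)             (here refl) = refl
  tower-sense (next _ _ _ _ _)      (here refl) = refl
  tower-sense (next _ ad e∈ ne tw) (there Y∈) with tower-step ad e∈ ne
  ... | d , a , v , refl = trans (tower-sense tw Y∈) (trans (tower-step-sense v tw) (sym (sense-almostDirected v)))


private
  toℚᵘ-/ : ∀ n k → toℚᵘ (n / suc k) ℚᵘ.≃ mkℚᵘ n k
  toℚᵘ-/ n k = ℚP.toℚᵘ-fromℚᵘ (mkℚᵘ n k)

ofℕ-+ : ∀ m n → ofℕ (m ℕ.+ n) ≡ ofℕ m ℚ.+ ofℕ n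
ofℕ-+ m n = ℚP.toℚᵘ-injective (begin
  toℚᵘ (ofℕ (m ℕ.+ n))              ≈⟨ toℚᵘ-/ (+ (m ℕ.+ n)) 0 ⟩
  mkℚᵘ (+ (m ℕ.+ n)) 0              ≈⟨ *≡* (cong (ℤ._* + 1) (trans (ℤP.pos-+ m n)
                                          (sym (cong₂ ℤ._+_ (ℤP.*-identityʳ (+ m)) (ℤP.*-identityʳ (+ n)))))) ⟩
  mkℚᵘ (+ m) 0 ℚᵘ.+ mkℚᵘ (+ n) 0    ≈⟨ ℚᵘP.+-cong (toℚᵘ-/ (+ m) 0) (toℚᵘ-/ (+ n) 0) ⟨
  toℚᵘ (ofℕ m) ℚᵘ.+ toℚᵘ (ofℕ n)    ≈⟨ ℚP.toℚᵘ-homo-+ (ofℕ m) (ofℕ n) ⟨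
  toℚᵘ (ofℕ m ℚ.+ ofℕ n)            ∎)
  where open ℚᵘP.≃-Reasoning

ofℕ-* : ∀ m n → ofℕ (m ℕ.* n) ≡ ofℕ m ℚ.* ofℕ n
ofℕ-* m n = ℚP.toℚᵘ-injective (begin
  toℚᵘ (ofℕ (m ℕ.* n))              ≈⟨ toℚᵘ-/ (+ (m ℕ.* n)) 0 ⟩
  mkℚᵘ (+ (m ℕ.* n)) 0              ≈⟨ *≡* (cong (ℤ._* + 1) (ℤP.pos-* m n)) ⟩
  mkℚᵘ (+ m) 0 ℚᵘ.* mkℚᵘ (+ n) 0    ≈⟨ ℚᵘP.*-cong (toℚᵘ-/ (+ m) 0) (toℚᵘ-/ (+ n) 0) ⟨
  toℚᵘ (ofℕ m) ℚᵘ.* toℚᵘ (ofℕ n)    ≈⟨ ℚP.toℚᵘ-homo-* (ofℕ m) (ofℕ n) ⟨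
  toℚᵘ (ofℕ m ℚ.* ofℕ n)            ∎)
  where open ℚᵘP.≃-Reasoning

inv-inverseˡ : ∀ k → inv (suc k) ℚ.* ofℕ (suc k) ≡ 1ℚ
inv-inverseˡ k = ℚP.toℚᵘ-injective (begin
  toℚᵘ (inv (suc k) ℚ.* ofℕ (suc k))          ≈⟨ ℚP.toℚᵘ-homo-* (inv (suc k)) (ofℕ (suc k)) ⟩
  toℚᵘ (inv (suc k)) ℚᵘ.* toℚᵘ (ofℕ (suc k))  ≈⟨ ℚᵘP.*-cong (toℚᵘ-/ (+ 1) k) (toℚᵘ-/ (+ suc k) 0) ⟩
  mkℚᵘ (+ 1) k ℚᵘ.* mkℚᵘ (+ suc k) 0          ≈⟨ *≡* (cong (λ n → + suc n) (cross k)) ⟩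
  toℚᵘ 1ℚ                                     ∎)
  where
  open ℚᵘP.≃-Reasoning
  cross : ∀ k → (k ℕ.+ 0 ℕ.* suc k) ℕ.* 1 ≡ k ℕ.* 1 ℕ.+ 0 ℕ.* suc (k ℕ.* 1)
  cross = solve-ℕ

inv-antitone : ∀ {m n} → m ≤ n → inv (suc n) ℚ.≤ inv (suc m)
inv-antitone {m} {n} m≤n = ℚP.toℚᵘ-cancel-≤ (ℚᵘP.≤-respˡ-≃ (ℚᵘP.≃-sym (toℚᵘ-/ (+ 1) n))
                                              (ℚᵘP.≤-respʳ-≃ (ℚᵘP.≃-sym (toℚᵘ-/ (+ 1) m))
                                                (*≤* (ℤP.*-monoˡ-≤-nonNeg (+ 1) (ℤ.+≤+ (s≤s m≤n))))))

-- The value DeltaBCond prescribes for c F when X moves with probability pX and Y with probability pY,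
-- in terms of the distances after both, only X, only Y or neither of them moved.  As in DeltaBCond,
-- where _-_ and _⊔_ share a precedence level, the last weight is (1 - pX) ⊔ pY; it multiplies 0.
expectedChange : (pX pY : ℚ) (both onlyX onlyY now : ℕ) → ℚ
expectedChange pX pY both onlyX onlyY now =
  (pX ℚ.⊓ pY) ℚ.* Δ both ℚ.+ (pX ℚ.- pX ℚ.⊓ pY) ℚ.* Δ onlyX ℚ.+ (pY ℚ.- pX ℚ.⊓ pY) ℚ.* Δ onlyY
    ℚ.+ ((1ℚ ℚ.- pX) ℚ.⊔ pY) ℚ.* Δ now
  where
  Δ : ℕ → ℚ
  Δ k = ofℕ k ℚ.- ofℕ now

expectedChange-merge : ∀ {pX pY} → pY ℚ.≤ pX → ∀ n k →
  expectedChange pX pY 0 (suc n) k 1 ≡ ofℕ n ℚ.* pX ℚ.- ofℕ (suc n) ℚ.* pY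
expectedChange-merge {pX} {pY} pY≤pX n k = begin
  expectedChange pX pY 0 (suc n) k 1
    ≡⟨ cong (λ m → shape m (ofℕ (suc n))) (ℚP.p≥q⇒p⊓q≡q pY≤pX) ⟩
  shape pY (ofℕ (suc n))
    ≡⟨ cong (shape pY) (ofℕ-+ 1 n) ⟩
  shape pY (1ℚ ℚ.+ ofℕ n)
    ≡⟨ identity pX pY (ofℕ n) (ofℕ k) ((1ℚ ℚ.- pX) ℚ.⊔ pY) ⟩
  ofℕ n ℚ.* pX ℚ.- (1ℚ ℚ.+ ofℕ n) ℚ.* pY
    ≡⟨ cong (λ s → ofℕ n ℚ.* pX ℚ.- s ℚ.* pY) (ofℕ-+ 1 n) ⟨
  ofℕ n ℚ.* pX ℚ.- ofℕ (suc n) ℚ.* pY ∎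
  where
  open ≡-Reasoning
  open +-*-Solver
  shape : ℚ → ℚ → ℚ
  shape m s = m ℚ.* (0ℚ ℚ.- 1ℚ) ℚ.+ (pX ℚ.- m) ℚ.* (s ℚ.- 1ℚ) ℚ.+ (pY ℚ.- m) ℚ.* (ofℕ k ℚ.- 1ℚ)
                ℚ.+ ((1ℚ ℚ.- pX) ℚ.⊔ pY) ℚ.* (1ℚ ℚ.- 1ℚ)
  identity : ∀ (p q N K w : ℚ) →
    q ℚ.* (0ℚ ℚ.- 1ℚ) ℚ.+ (p ℚ.- q) ℚ.* ((1ℚ ℚ.+ N) ℚ.- 1ℚ) ℚ.+ (q ℚ.- q) ℚ.* (K ℚ.- 1ℚ)
      ℚ.+ w ℚ.* (1ℚ ℚ.- 1ℚ)
      ≡ N ℚ.* p ℚ.- (1ℚ ℚ.+ N) ℚ.* q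
  identity = solve 5 (λ p q N K w → q :* (con 0ℚ :- con 1ℚ) :+ (p :- q) :* ((con 1ℚ :+ N) :- con 1ℚ)
                                    :+ (q :- q) :* (K :- con 1ℚ) :+ w :* (con 1ℚ :- con 1ℚ)
                                    := N :* p :- (con 1ℚ :+ N) :* q) refl

expectedChange-cong : ∀ pX pY k {a b e n} → a ≡ 0 → b ≡ suc n → e ≡ 1 →
                      expectedChange pX pY a b k e ≡ expectedChange pX pY 0 (suc n) k 1
expectedChange-cong pX pY k refl refl refl = refl

ofℕ*inv-3* : ∀ k → ofℕ (suc k) ℚ.* inv (3 ℕ.* suc k) ≡ + 1 / 3
ofℕ*inv-3* k = begin
  N ℚ.* p                               ≡⟨ regroup N p ⟩
  (+ 1 / 3) ℚ.* (p ℚ.* (ofℕ 3 ℚ.* N))   ≡⟨ cong (λ q → (+ 1 / 3) ℚ.* (p ℚ.* q)) (ofℕ-* 3 (suc k)) ⟨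
  (+ 1 / 3) ℚ.* (p ℚ.* ofℕ (3 ℕ.* suc k)) ≡⟨ cong ((+ 1 / 3) ℚ.*_) (inv-inverseˡ (k ℕ.+ 2 ℕ.* suc k)) ⟩
  (+ 1 / 3) ℚ.* 1ℚ                      ≡⟨ ℚP.*-identityʳ (+ 1 / 3) ⟩
  + 1 / 3                               ∎
  where
  open ≡-Reasoning
  open +-*-Solver
  N = ofℕ (suc k)
  p = inv (3 ℕ.* suc k)
  regroup : ∀ (N p : ℚ) → N ℚ.* p ≡ (+ 1 / 3) ℚ.* (p ℚ.* (ofℕ 3 ℚ.* N))
  regroup = solve 2 (λ N p → N :* p := con (+ 1 / 3) :* (p :* (con (ofℕ 3) :* N))) refl

inv-2*-two-thirds : ∀ n → inv (2 ℕ.* n) ℚ.* (+ 2 / 3) ≡ inv (3 ℕ.* n)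
inv-2*-two-thirds zero    = refl
inv-2*-two-thirds (suc k) = begin
  a ℚ.* (+ 2 / 3)                               ≡⟨ ℚP.*-identityʳ _ ⟨
  a ℚ.* (+ 2 / 3) ℚ.* 1ℚ                        ≡⟨ cong (a ℚ.* (+ 2 / 3) ℚ.*_) (inv-inverseˡ (k ℕ.+ 2 ℕ.* suc k)) ⟨
  a ℚ.* (+ 2 / 3) ℚ.* (b ℚ.* ofℕ (3 ℕ.* suc k)) ≡⟨ cong (λ q → a ℚ.* (+ 2 / 3) ℚ.* (b ℚ.* q)) (ofℕ-* 3 (suc k)) ⟩
  a ℚ.* (+ 2 / 3) ℚ.* (b ℚ.* (ofℕ 3 ℚ.* N))     ≡⟨ regroup a b N ⟩
  b ℚ.* (a ℚ.* (ofℕ 2 ℚ.* N))                   ≡⟨ cong (λ q → b ℚ.* (a ℚ.* q)) (ofℕ-* 2 (suc k)) ⟨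
  b ℚ.* (a ℚ.* ofℕ (2 ℕ.* suc k))               ≡⟨ cong (b ℚ.*_) (inv-inverseˡ (k ℕ.+ 1 ℕ.* suc k)) ⟩
  b ℚ.* 1ℚ                                      ≡⟨ ℚP.*-identityʳ b ⟩
  b                                             ∎
  where
  open ≡-Reasoning
  open +-*-Solver
  a = inv (2 ℕ.* suc k)
  b = inv (3 ℕ.* suc k)
  N = ofℕ (suc k)
  regroup : ∀ (a b N : ℚ) → a ℚ.* (+ 2 / 3) ℚ.* (b ℚ.* (ofℕ 3 ℚ.* N)) ≡ b ℚ.* (a ℚ.* (ofℕ 2 ℚ.* N))
  regroup = solve 3 (λ a b N → a :* con (+ 2 / 3) :* (b :* (con (ofℕ 3) :* N)) := b :* (a :* (con (ofℕ 2) :* N))) refl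

inv-3*-antitone : ∀ k → inv (3 ℕ.* suc (suc k)) ℚ.≤ inv (3 ℕ.* suc k)
inv-3*-antitone k = inv-antitone (ℕ.s≤s⁻¹ (ℕP.*-monoʳ-≤ 3 (ℕP.n≤1+n (suc k))))

inv-6≤1 : inv 6 ℚ.≤ 1ℚ
inv-6≤1 = inv-antitone {0} {5} z≤n

sumℚ-zero : ∀ {X : Set} (f : X → ℚ) (L : List X) → (∀ {y} → y ∈ L → f y ≡ 0ℚ) → sumℚ (map f L) ≡ 0ℚ
sumℚ-zero f []      _      = refl
sumℚ-zero f (y ∷ L) vanish = cong₂ ℚ._+_ (vanish (here refl)) (sumℚ-zero f L (λ y∈L → vanish (there y∈L)))

sumℚ-concentrated : ∀ {X : Set} (f : X → ℚ) {L : List X} {x} → Unique L → x ∈ L →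
                    (∀ {y} → y ∈ L → y ≢ x → f y ≡ 0ℚ) → sumℚ (map f L) ≡ f x
sumℚ-concentrated f {y ∷ L} (y∉L ∷ _) (here refl) vanish =
  trans (cong (f y ℚ.+_) (sumℚ-zero f L λ z∈L → vanish (there z∈L) λ z≡y → All.lookup y∉L z∈L (sym z≡y)))
        (ℚP.+-identityʳ (f y))
sumℚ-concentrated f {y ∷ L} (y∉L ∷ uL) (there x∈L) vanish =
  trans (cong₂ ℚ._+_ (vanish (here refl) λ y≡x → All.lookup y∉L x∈L y≡x)
                     (sumℚ-concentrated f uL x∈L λ z∈L → vanish (there z∈L)))
        (ℚP.+-identityˡ _)

private
  climb-sign : ∀ b (x y : ℤ) → x ≡ y ℤ.+ sign (not b) → sign b ℤ.* y ≡ sign b ℤ.* x ℤ.+ + 1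
  climb-sign true  _ y refl = lemma y
    where
    lemma : ∀ (y : ℤ) → + 1 ℤ.* y ≡ + 1 ℤ.* (y ℤ.+ -[1+ 0 ]) ℤ.+ + 1
    lemma = solve-∀
  climb-sign false _ y refl = lemma y
    where
    lemma : ∀ (y : ℤ) → -[1+ 0 ] ℤ.* y ≡ -[1+ 0 ] ℤ.* (y ℤ.+ + 1) ℤ.+ + 1
    lemma = solve-∀

  descend-sign : ∀ b (x y : ℤ) → x ≡ y ℤ.+ sign b → sign b ℤ.* x ≡ sign b ℤ.* y ℤ.+ + 1
  descend-sign true  _ y refl = lemma y
    where
    lemma : ∀ (y : ℤ) → + 1 ℤ.* (y ℤ.+ + 1) ≡ + 1 ℤ.* y ℤ.+ + 1
    lemma = solve-∀
  descend-sign false _ y refl = lemma y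
    where
    lemma : ∀ (y : ℤ) → -[1+ 0 ] ℤ.* (y ℤ.+ -[1+ 0 ]) ≡ -[1+ 0 ] ℤ.* y ℤ.+ + 1
    lemma = solve-∀

  x<x+1 : ∀ x → x ℤ.< x ℤ.+ + 1
  x<x+1 x = ℤP.suc[i]≤j⇒i<j (ℤP.≤-reflexive (ℤP.+-comm (+ 1) x))

module Configuration
  (S : List Face) (σ₁ : Orientation) (eo₁ : IsEO S σ₁)
  (A B : Face) (A∈S : A ∈ S) (B∈S : B ∈ S) (A-dir : Directed σ₁ A)
  (dA : Fin 3) (A≡ : A ≡ neighbour B dA) (b : Bool) (B-dir : DirectedAs σ₁ B b)
  (h : Face → ℤ) (h-height : IsHeight S σ₁ h)
  where

  σ₂ : Orientation
  σ₂ = reverseFaces σ₁ (A ∷ [])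

  module T₁ = Towers S σ₁
  module T₂ = Towers S σ₂

  B≢A : B ≢ A
  B≢A B≡A = neighbour-≢ B dA (sym (trans B≡A A≡))

  A-directed : DirectedAs σ₁ A (not b)
  A-directed = directed λ d → trans (side w d) (trans (sym (side w dA)) A-dA)
    where
    w = Directed⇒DirectedAs σ₁ A A-dir
    A-dA : flag σ₁ A dA ≡ not b
    A-dA = trans (cong (λ X → flag σ₁ X dA) A≡) (trans (flag-neighbour σ₁ B dA) (cong not (side B-dir dA)))

  A-directed₂ : DirectedAs σ₂ A b
  A-directed₂ = subst (DirectedAs σ₂ A) (not-involutive b) (reverseFace-directed σ₁ A A-directed)

  B-almostDirected₂ : AlmostDirectedAs σ₂ B dA b
  B-almostDirected₂ = almostDirected sides
    where
    sides : ∀ d → flag σ₂ B d ≡ does (d Fin.≟ dA) xor b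
    sides d with flag-reverseFaces σ₁ (A ∷ []) B d
    ... | flag≡ with B ≟F A | neighbour B d ≟F A
    ...   | yes B≡A | _ = ⊥-elim (B≢A B≡A)
    ...   | no _ | yes B′≡A with neighbour-injective B (trans B′≡A A≡)
    ...     | refl = trans flag≡ (trans (cong (_xor true) (side B-dir d))
                                        (trans (xor-comm b true) (cong (_xor b) (sym (dec-true (d Fin.≟ d) refl)))))
    sides d | flag≡ | no _ | no B′≢A =
      trans flag≡ (trans (xor-identityʳ _) (trans (side B-dir d)
        (cong (_xor b) (sym (dec-false (d Fin.≟ dA) λ d≡dA → B′≢A (trans (cong (neighbour B) d≡dA) (sym A≡)))))))

  flag₂≡flag₁ : ∀ {X} → X ≢ A → (∀ d → neighbour X d ≢ A) → ∀ d → flag σ₂ X d ≡ flag σ₁ X d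
  flag₂≡flag₁ {X} X≢A far d with flag-reverseFaces σ₁ (A ∷ []) X d
  ... | flag≡ with X ≟F A | neighbour X d ≟F A
  ...   | yes X≡A | _        = ⊥-elim (X≢A X≡A)
  ...   | no _    | yes X′≡A = ⊥-elim (far d X′≡A)
  ...   | no _    | no _     = trans flag≡ (xor-identityʳ _)

  level : Face → ℤ
  level X = sign b ℤ.* h X

  climbs : ∀ {X} d → X ∈ S → flag σ₁ X d ≡ not b → level (neighbour X d) ≡ level X ℤ.+ + 1
  climbs {X} d X∈S f = climb-sign b (h X) (h (neighbour X d))
    (trans (h-height X d (X , X∈S , edge∈edgesOf X d)) (cong (λ f → h (neighbour X d) ℤ.+ sign f) f))

  descends : ∀ {X} d → X ∈ S → flag σ₁ X d ≡ b → level X ≡ level (neighbour X d) ℤ.+ + 1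
  descends {X} d X∈S f = descend-sign b (h X) (h (neighbour X d))
    (trans (h-height X d (X , X∈S , edge∈edgesOf X d)) (cong (λ f → h (neighbour X d) ℤ.+ sign f) f))

  near-A⇒level-B : ∀ {X} d → neighbour X d ≡ A → level X ≡ level B
  near-A⇒level-B {X} d X′≡A = begin
    level X
      ≡⟨ cong level (trans (sym (neighbour-involutive X d)) (cong (λ Y → neighbour Y d) X′≡A)) ⟩
    level (neighbour A d)
      ≡⟨ climbs d A∈S (side A-directed d) ⟩
    level A ℤ.+ + 1
      ≡⟨ cong (λ Y → level Y ℤ.+ + 1) A≡ ⟩
    level (neighbour B dA) ℤ.+ + 1
      ≡⟨ descends dA B∈S (side B-dir dA) ⟨
    level B ∎
    where open ≡-Reasoning

  -- The towers in σ₁ whose top is B: every face is almost-directed with the sense b of B.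
  data Ascent : Face → List Face → Set where
    summit : Ascent B (B ∷ [])
    climb  : ∀ {X d L} → X ∈ S → AlmostDirectedAs σ₁ X d b → Ascent (neighbour X d) L → Ascent X (X ∷ L)

  ascent⊆S : ∀ {X L} → Ascent X L → ∀ {Y} → Y ∈ L → Y ∈ S
  ascent⊆S summit             (here refl) = B∈S
  ascent⊆S (climb X∈S _ _)    (here refl) = X∈S
  ascent⊆S (climb _ _ rest)   (there Y∈)  = ascent⊆S rest Y∈

  ascent-start : ∀ {X L} → Ascent X L → X ∈ L
  ascent-start summit        = here refl
  ascent-start (climb _ _ _) = here refl

  ascent-top : ∀ {X L} → Ascent X L → B ∈ L
  ascent-top summit           = here refl
  ascent-top (climb _ _ rest) = there (ascent-top rest)

  step-climbs : ∀ {X d} → X ∈ S → AlmostDirectedAs σ₁ X d b → level X ℤ.< level (neighbour X d)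
  step-climbs {X} {d} X∈S v =
    subst (level X ℤ.<_) (sym (climbs d X∈S (almostDirectedAs-blocking v))) (x<x+1 (level X))

  ascent-above : ∀ {X L} → Ascent X L → All (λ Y → level X ℤ.≤ level Y) L
  ascent-above summit = ℤP.≤-refl ∷ []
  ascent-above (climb X∈S v rest) = ℤP.≤-refl ∷ All.map (ℤP.≤-trans (ℤP.<⇒≤ (step-climbs X∈S v))) (ascent-above rest)

  rest-above : ∀ {X d L} → X ∈ S → AlmostDirectedAs σ₁ X d b → Ascent (neighbour X d) L →
               All (λ Y → level X ℤ.< level Y) L
  rest-above X∈S v rest = All.map (ℤP.<-≤-trans (step-climbs X∈S v)) (ascent-above rest)

  below-summit : ∀ {X d L} → X ∈ S → AlmostDirectedAs σ₁ X d b → Ascent (neighbour X d) L → level X ℤ.< level B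
  below-summit X∈S v rest = All.lookup (rest-above X∈S v rest) (ascent-top rest)

  ascent-unique : ∀ {X L} → Ascent X L → Unique L
  ascent-unique summit = [] ∷ []
  ascent-unique (climb X∈S v rest) =
    All.map (λ lt X≡Y → ℤP.<-irrefl (cong level X≡Y) lt) (rest-above X∈S v rest) ∷ ascent-unique rest

  climber≢A : ∀ {X d} → AlmostDirectedAs σ₁ X d b → X ≢ A
  climber≢A v refl = directed⇒¬almostDirected A-directed v

  climber-far-from-A : ∀ {X d L} → X ∈ S → AlmostDirectedAs σ₁ X d b → Ascent (neighbour X d) L →
                       ∀ d′ → neighbour X d′ ≢ A
  climber-far-from-A X∈S v rest d′ X′≡A = ℤP.<-irrefl (near-A⇒level-B d′ X′≡A) (below-summit X∈S v rest)

  A∉ascent : ∀ {X L} → Ascent X L → ¬ A ∈ L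
  A∉ascent summit             (here A≡B)  = B≢A (sym A≡B)
  A∉ascent (climb _ v _)      (here A≡X)  = climber≢A v (sym A≡X)
  A∉ascent (climb _ _ rest)   (there A∈)  = A∉ascent rest A∈

  ascent⇒tower : ∀ {X L} → Ascent X L → Tower S σ₁ X L
  ascent⇒tower summit = top B∈S (DirectedAs⇒Directed σ₁ B B-dir)
  ascent⇒tower (climb {X} {d} X∈S v rest) =
    next X∈S (AlmostDirectedAs⇒AlmostDirected σ₁ X d v) (edge∈edgesOf-neighbour X d) (neighbour-≢ X d) (ascent⇒tower rest)

  tower⇒ascent : ∀ {X L} → Tower S σ₁ X L → B ∈ L → Ascent X L
  tower⇒ascent (top _ _)               (here refl) = summit
  tower⇒ascent (next X∈S ad e∈ ne tw) B∈ with T₁.tower-step ad e∈ ne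
  ... | d , a , v , refl with B∈
  ...   | here refl = ⊥-elim (directed⇒¬almostDirected B-dir v)
  ...   | there B∈T = climb X∈S (subst (AlmostDirectedAs σ₁ _ d) a≡b v) (tower⇒ascent tw B∈T)
    where
    a≡b : a ≡ b
    a≡b = trans (sym (T₁.tower-step-sense v tw)) (trans (sym (T₁.tower-sense tw B∈T)) (sense-directed B-dir))

  climber-almostDirected₂ : ∀ {X d L} → X ∈ S → AlmostDirectedAs σ₁ X d b → Ascent (neighbour X d) L →
                            AlmostDirectedAs σ₂ X d b
  climber-almostDirected₂ X∈S v rest =
    almostDirected λ d′ → trans (flag₂≡flag₁ (climber≢A v) (climber-far-from-A X∈S v rest) d′) (side v d′)

  ascent-extends : ∀ {X L} → Ascent X L → Tower S σ₂ X (L ++ A ∷ [])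
  ascent-extends summit =
    next B∈S (AlmostDirectedAs⇒AlmostDirected σ₂ B dA B-almostDirected₂)
         (subst (λ Y → edge B dA ∈ edgesOf Y) (sym A≡) (edge∈edgesOf-neighbour B dA)) (λ A≡B → B≢A (sym A≡B))
         (top A∈S (DirectedAs⇒Directed σ₂ A A-directed₂))
  ascent-extends (climb {X} {d} X∈S v rest) =
    next X∈S (AlmostDirectedAs⇒AlmostDirected σ₂ X d (climber-almostDirected₂ X∈S v rest))
         (edge∈edgesOf-neighbour X d) (neighbour-≢ X d) (ascent-extends rest)

  ascent-not-directed₂ : ∀ {X L} → Ascent X L → ¬ Directed σ₂ X
  ascent-not-directed₂ summit X-dir =
    directed⇒¬almostDirected (Directed⇒DirectedAs σ₂ B X-dir) B-almostDirected₂
  ascent-not-directed₂ (climb X∈S v rest) X-dir =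
    directed⇒¬almostDirected (Directed⇒DirectedAs σ₂ _ X-dir) (climber-almostDirected₂ X∈S v rest)

  -- Reversing A only changes the faces touching A, and a σ₂-tower does not touch A before it
  -- reaches B, so up to B it is a σ₁-tower.
  σ₂-step⇒σ₁-step : ∀ {X d a T} → AlmostDirectedAs σ₂ X d a → Tower S σ₂ (neighbour X d) T → B ∈ T →
                    AlmostDirectedAs σ₁ X d b
  σ₂-step⇒σ₁-step {X} {d} {a} v₂ tw B∈T =
    almostDirected λ d′ → trans (sym (flag₂≡flag₁ X≢A far d′))
                                (trans (side v₂ d′) (cong (does (d′ Fin.≟ d) xor_) a≡b))
    where
    a≡b : a ≡ b
    a≡b = trans (sym (T₂.tower-step-sense v₂ tw))
                (trans (sym (T₂.tower-sense tw B∈T)) (sense-almostDirected B-almostDirected₂))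
    X≢A : X ≢ A
    X≢A refl = directed⇒¬almostDirected A-directed₂ v₂
    far : ∀ d′ → neighbour X d′ ≢ A
    far d′ X′≡A with d′ Fin.≟ d
    ... | yes refl with T₂.tower-directed (subst (λ Y → DirectedAs σ₂ Y b) (sym X′≡A) A-directed₂) tw
    ...   | refl = B≢A (trans (∈-singleton B∈T) X′≡A)
      where
      ∈-singleton : ∀ {x y : Face} → x ∈ y ∷ [] → x ≡ y
      ∈-singleton (here x≡y) = x≡y
    far d′ X′≡A | no d′≢d = not≢self (trans (sym toward-A) away-from-A)
      where
      toward-A : flag σ₂ X d′ ≡ not b
      toward-A = trans (cong (λ Y → flag σ₂ Y d′)
                             (trans (sym (neighbour-involutive X d′)) (cong (λ Y → neighbour Y d′) X′≡A)))
                       (trans (flag-neighbour σ₂ A d′) (cong not (side A-directed₂ d′)))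
      away-from-A : flag σ₂ X d′ ≡ b
      away-from-A = trans (almostDirectedAs-unblocked v₂ d′ d′≢d) a≡b

  tower₂⇒ascent : ∀ {X L} → Tower S σ₂ X L → B ∈ L → X ≢ B → Σ (List Face) (Ascent X)
  tower₂⇒ascent (top _ _) (here refl) X≢B = ⊥-elim (X≢B refl)
  tower₂⇒ascent {X} (next X∈S ad e∈ ne tw) B∈ X≢B with T₂.tower-step ad e∈ ne
  ... | d , a , v₂ , refl with B∈
  ...   | here refl = ⊥-elim (X≢B refl)
  ...   | there B∈T with neighbour X d ≟F B
  ...     | yes refl = _ , climb X∈S (σ₂-step⇒σ₁-step v₂ tw B∈T) summit
  ...     | no X′≢B  = _ , climb X∈S (σ₂-step⇒σ₁-step v₂ tw B∈T) (proj₂ (tower₂⇒ascent tw B∈T X′≢B))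

  -- In σ₁ ⊕ T the face X below the rest T of an ascent is directed: its blocking side is reversed
  -- once (as a side of the next face), its other two sides not at all, because the neighbours
  -- across them lie one level below X, and T lies above X.
  ascent-uncovers : ∀ {X d T} → X ∈ S → AlmostDirectedAs σ₁ X d b → Ascent (neighbour X d) T →
                    DirectedAs (reverseFaces σ₁ T) X b
  ascent-uncovers {X} {d} {T} X∈S v rest = directed λ d′ → trans (flag-reverseFaces σ₁ T X d′) (uncovered d′)
    where
    above = rest-above X∈S v rest
    X∉T : ¬ X ∈ T
    X∉T X∈T = ℤP.<-irrefl refl (All.lookup above X∈T)
    below-T : ∀ d′ → d′ ≢ d → ¬ neighbour X d′ ∈ T
    below-T d′ d′≢d X′∈T =
      ℤP.<-asym (subst (level (neighbour X d′) ℤ.<_) (sym (descends d′ X∈S (almostDirectedAs-unblocked v d′ d′≢d)))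
                       (x<x+1 (level (neighbour X d′))))
                (All.lookup above X′∈T)
    uncovered : ∀ d′ → flag σ₁ X d′ xor odd (occurrences X T ℕ.+ occurrences (neighbour X d′) T) ≡ b
    uncovered d′ rewrite ∉⇒occurrences≡0 X T X∉T with d′ Fin.≟ d
    ... | yes refl rewrite Unique-∈⇒occurrences≡1 (neighbour X d) T (ascent-unique rest) (ascent-start rest)
                         | almostDirectedAs-blocking v = not-xor-true b
      where
      not-xor-true : ∀ b → not b xor true ≡ b
      not-xor-true true  = refl
      not-xor-true false = refl
    ... | no d′≢d rewrite ∉⇒occurrences≡0 (neighbour X d′) T (below-T d′ d′≢d)
                        | almostDirectedAs-unblocked v d′ d′≢d = xor-identityʳ b

  ascent-reversal : ∀ {X L} → Ascent X L → Path S (length L) (reverseFaces σ₁ L) σ₁ × IsEO S (reverseFaces σ₁ L)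
  ascent-reversal summit = unflip eo₁ B∈S B-dir
  ascent-reversal (climb {X} {L = T} X∈S v rest) =
    path-respects-start starts (path-++ (proj₁ last) (proj₁ earlier)) ,
    IsEO-cong S (proj₂ last) (λ e e∈G → sym (starts e e∈G))
    where
    earlier = ascent-reversal rest
    last = unflip (proj₂ earlier) X∈S (ascent-uncovers X∈S v rest)
    starts : ∀ e → InG S e → reverseFaces σ₁ (X ∷ T) e ≡ reverseFaces (reverseFaces σ₁ T) (X ∷ []) e
    starts e _ = trans (sym (reverseFaces-++ σ₁ (X ∷ []) T e)) (reverseFaces-comm σ₁ (X ∷ []) T e)

  module Distances (d : Orientation → Orientation → ℕ) (dist : IsDistFn S d) where

    eo₂ : IsEO S σ₂
    eo₂ = IsEO-reverseFace eo₁ A∈S A-directed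

    σ₁→σ₂ : Path S 1 σ₁ σ₂
    σ₁→σ₂ = flipFace A∈S A-dir (here λ _ _ → refl)

    d-σ₁-σ₂ : d σ₁ σ₂ ≡ 1
    d-σ₁-σ₂ = distance-by-parity S d dist eo₁ eo₂ (A ∷ []) ([] ∷ []) (λ { (here refl) → A∈S })
                                 (λ _ _ → refl) σ₁→σ₂

    module _ {X L} (asc : Ascent X L) where

      X′ Y′ : Orientation
      X′ = reverseFaces σ₁ L
      Y′ = reverseFaces σ₂ (L ++ A ∷ [])

      Y′≡X′ : ∀ e → Y′ e ≡ X′ e
      Y′≡X′ = reverseFaces-absorb σ₁ L (A ∷ [])

      eo-X′ : IsEO S X′
      eo-X′ = proj₂ (ascent-reversal asc)

      d-X′-Y′ : d X′ Y′ ≡ 0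
      d-X′-Y′ = distance-by-parity S d dist eo-X′ (IsEO-cong S eo-X′ λ e _ → sym (Y′≡X′ e)) [] [] (λ ())
                  (λ e _ → trans (Y′≡X′ e) (sym (xor-identityʳ (X′ e)))) (here λ e _ → sym (Y′≡X′ e))

      d-X′-σ₂ : d X′ σ₂ ≡ suc (length L)
      d-X′-σ₂ = distance-by-parity S d dist eo-X′ eo₂ (A ∷ L)
                  (¬Any⇒All¬ L (A∉ascent asc) ∷ ascent-unique asc)
                  (λ { (here refl) → A∈S ; (there Y∈L) → ascent⊆S asc Y∈L })
                  (λ e _ → sym (reverseFaces-absorb σ₁ (A ∷ []) L e))
                  (subst (λ n → Path S n X′ σ₂) (ℕP.+-comm (length L) 1)
                         (path-++ (proj₁ (ascent-reversal asc)) σ₁→σ₂))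

    ascent-start≢A : ∀ {X L} → Ascent X L → X ≢ A
    ascent-start≢A asc refl = A∉ascent asc (ascent-start asc)

    module _ (c : Face → ℚ) (hc : DeltaBCond S d A B σ₁ σ₂ c) where

      c-ascent : ∀ {X L} (asc : Ascent X L) → ∀ {pX} → Move S σ₁ X pX L →
                 c X ≡ expectedChange pX (inv (3 ℕ.* length (L ++ A ∷ []))) 0 (suc (length L)) (d σ₁ (Y′ asc)) 1
      c-ascent {X} {L} asc {pX} X-move =
        trans (proj₂ (proj₂ (hc X (ascent⊆S asc (ascent-start asc)))) (ascent-start≢A asc)
                 (inj₁ (inj₂ (L , ascent⇒tower asc , ascent-top asc)))
                 pX L _ (L ++ A ∷ []) X-move (mvTower (ascent-not-directed₂ asc) (ascent-extends asc)))
              (expectedChange-cong pX (inv (3 ℕ.* length (L ++ A ∷ []))) (d σ₁ (Y′ asc))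
                                   (d-X′-Y′ asc) (d-X′-σ₂ asc) d-σ₁-σ₂)

      c-summit : c B ≡ + 2 / 3
      c-summit = begin
        c B                                           ≡⟨ c-ascent summit (mvDir (DirectedAs⇒Directed σ₁ B B-dir)) ⟩
        expectedChange 1ℚ (inv 6) 0 2 (d σ₁ (Y′ summit)) 1 ≡⟨ expectedChange-merge inv-6≤1 1 (d σ₁ (Y′ summit)) ⟩
        ofℕ 1 ℚ.* 1ℚ ℚ.- ofℕ 2 ℚ.* inv 6             ≡⟨ refl ⟩
        + 2 / 3                                       ∎
        where open ≡-Reasoning

      c-climber : ∀ {X L} → Ascent X L → X ≢ B → c X ≡ 0ℚ
      c-climber summit B≢B = ⊥-elim (B≢B refl)
      c-climber asc@(climb {X} {L = T} X∈S v rest) _ = begin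
        c X
          ≡⟨ c-ascent asc (mvTower (λ X-dir → directed⇒¬almostDirected (Directed⇒DirectedAs σ₁ X X-dir) v)
                                   (ascent⇒tower asc)) ⟩
        expectedChange (inv (3 ℕ.* n)) (inv (3 ℕ.* suc (length (T ++ A ∷ [])))) 0 (suc n) k 1
          ≡⟨ cong (λ m → expectedChange (inv (3 ℕ.* n)) (inv (3 ℕ.* suc m)) 0 (suc n) k 1) length-T+A ⟩
        expectedChange (inv (3 ℕ.* n)) (inv (3 ℕ.* suc n)) 0 (suc n) k 1
          ≡⟨ expectedChange-merge (inv-3*-antitone (length T)) n k ⟩
        ofℕ n ℚ.* inv (3 ℕ.* n) ℚ.- ofℕ (suc n) ℚ.* inv (3 ℕ.* suc n)
          ≡⟨ cong₂ ℚ._-_ (ofℕ*inv-3* (length T)) (ofℕ*inv-3* n) ⟩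
        + 1 / 3 ℚ.- + 1 / 3
          ≡⟨ ℚP.+-inverseʳ (+ 1 / 3) ⟩
        0ℚ ∎
        where
        open ≡-Reasoning
        n = suc (length T)
        k = d σ₁ (Y′ asc)
        length-T+A : length (T ++ A ∷ []) ≡ n
        length-T+A = trans (ListP.length-++ T) (ℕP.+-comm (length T) 1)

      -- Whether the move at F involves B need not be decidable, but c F ≡ 0ℚ is.
      c-elsewhere : ∀ {F} → F ∈ S → F ≢ B → c F ≡ 0ℚ
      c-elsewhere {F} F∈S F≢B = by-cases (F ≟F A)
        where
        via : Involves S σ₁ F B ⊎ Involves S σ₂ F B → c F ≡ 0ℚ
        via (inj₁ (inj₁ F≡B))             = ⊥-elim (F≢B F≡B)
        via (inj₁ (inj₂ (_ , tw , B∈)))   = c-climber (tower⇒ascent tw B∈) F≢B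
        via (inj₂ (inj₁ F≡B))             = ⊥-elim (F≢B F≡B)
        via (inj₂ (inj₂ (_ , tw , B∈)))   = c-climber (proj₂ (tower₂⇒ascent tw B∈ F≢B)) F≢B
        by-cases : Dec (F ≡ A) → c F ≡ 0ℚ
        by-cases (yes F≡A) = proj₁ (hc F F∈S) F≡A
        by-cases (no  F≢A) = decidable-stable (c F ℚP.≟ 0ℚ) λ c≢0 →
                               c≢0 (proj₁ (proj₂ (hc F F∈S)) F≢A λ involved → c≢0 (via involved))

lemma7 : (S : List Face) → Solid S → Eulerian S →
    (σ₁ : Orientation) → IsEO S σ₁ →
    (A : Face) → A ∈ S → Directed σ₁ A →
    (B : Face) → B ∈ S → B ≢ A →
    (Σ Edge λ e → e ∈ edgesOf A × e ∈ edgesOf B) → Directed σ₁ B →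
    (d : Orientation → Orientation → ℕ) → IsDistFn S d →
    (c : Face → ℚ) → DeltaBCond S d A B σ₁ (reverseFaces σ₁ (A ∷ [])) c →
    ExpDeltaB S c ≡ inv (3 ℕ.* length S)
lemma7 S solid _ σ₁ eo₁ A A∈S A-dir B B∈S B≢A (e , e∈A , e∈B) B-dir d dist c hc = begin
  sumℚ (map (λ F → w ℚ.* c F) S)  ≡⟨ sumℚ-concentrated (λ F → w ℚ.* c F) (proj₁ solid) B∈S vanishes ⟩
  w ℚ.* c B                        ≡⟨ cong (w ℚ.*_) (c-summit c hc) ⟩
  w ℚ.* (+ 2 / 3)                  ≡⟨ inv-2*-two-thirds (length S) ⟩
  inv (3 ℕ.* length S)             ∎
  where
  open ≡-Reasoning
  w = inv (2 ℕ.* length S)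
  A≡ : A ≡ neighbour B (proj₂ e)
  A≡ = [ (λ A≡B → ⊥-elim (B≢A (sym A≡B))) , (λ A≡B′ → A≡B′) ]′
         (edge-shared A B (proj₂ e) (trans (∈edgesOf⇒edge A e∈A) (sym (∈edgesOf⇒edge B e∈B))))
  reversal : Path S (d σ₁ (λ e → not (σ₁ e))) σ₁ (λ e → not (σ₁ e))
  reversal = proj₁ (dist σ₁ (λ e → not (σ₁ e)) eo₁ (IsEO-reverse S σ₁ eo₁))
  open Configuration S σ₁ eo₁ A B A∈S B∈S A-dir (proj₂ e) A≡ (flag σ₁ B d0) (Directed⇒DirectedAs σ₁ B B-dir)
                     (netFlips reversal) (reversal⇒height reversal)
  open Distances d dist
  vanishes : ∀ {F} → F ∈ S → F ≢ B → w ℚ.* c F ≡ 0ℚ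
  vanishes F∈S F≢B = trans (cong (w ℚ.*_) (c-elsewhere c hc F∈S F≢B)) (ℚP.*-zeroʳ w)
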